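{- Let $m,n,r$ be positive integers. There exists a signed magic rectangle $SMR(m,n;r,2)$ if and only if either $m=2$ and $n=r\equiv 0$ or $3 \pmod 4$, or $m\geq 3$, $r\geq 3$ and $mr=2n$.
   Context: A signed magic rectangle $SMR(m,n;r,s)$ is an $m\times n$ array, some of whose cells are filled with integers and the others empty, such that exactly $r$ cells in every row and exactly $s$ cells in every column are filled (so $mr=ns$), every element of a set $X$ appears exactly once in the array, and the sum of the entries of each row and of each column is zero. Here $X=\{\pm1,\pm2,\ldots,\pm mr/2\}$ if $mr$ is even, and $X=\{0,\pm1,\ldots,\pm (mr-1)/2\}$ if $mr$ is odd. -}

module Defs where

open import Data.Nat as ℕ using (ℕ; zero; suc; _/_; _%_)
open import Data.Integer as ℤ using (ℤ; +_; -_)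
open import Data.Fin using (Fin)
open import Data.List using (List; []; _∷_; map; concatMap; catMaybes; length; foldr; upTo; _++_)
open import Data.List.Relation.Binary.Permutation.Propositional using (_↭_)
open import Data.Maybe using (Maybe)
open import Data.Product using (_×_)
open import Relation.Binary.PropositionalEquality using (_≡_)
open import Data.Fin using (Fin)
open import Data.List using (allFin)

-- A partially filled m × n array: nothing = empty cell, just x = cell filled with x.
PArray : ℕ → ℕ → Set
PArray m n = Fin m → Fin n → Maybe ℤ

rowEntries : ∀ {m n} → PArray m n → Fin m → List ℤ
rowEntries {n = n} A i = catMaybes (map (λ j → A i j) (allFin n))

colEntries : ∀ {m n} → PArray m n → Fin n → List ℤ
colEntries {m = m} A j = catMaybes (map (λ i → A i j) (allFin m))

allEntries : ∀ {m n} → PArray m n → List ℤ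
allEntries {m = m} A = concatMap (rowEntries A) (allFin m)

posUpTo : ℕ → List ℤ
posUpTo k = map (λ i → + (suc i)) (upTo k)

pmUpTo : ℕ → List ℤ
pmUpTo k = posUpTo k ++ map -_ (posUpTo k)

-- the set X of the definition, for N = m r filled cells:
-- {±1,...,±N/2} if N even, {0,±1,...,±(N-1)/2} if N odd
symSet : ℕ → List ℤ
symSet N with N % 2
... | zero = pmUpTo (N / 2)
... | suc _ = + 0 ∷ pmUpTo (N / 2)

sumℤ : List ℤ → ℤ
sumℤ = foldr ℤ._+_ (+ 0)

record IsSMR (m n r s : ℕ) (A : PArray m n) : Set where
  field
    rowCount : ∀ i → length (rowEntries A i) ≡ r
    colCount : ∀ j → length (colEntries A j) ≡ s
    cardEq   : m ℕ.* r ≡ n ℕ.* s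
    entries  : allEntries A ↭ symSet (m ℕ.* r)
    rowSum   : ∀ i → sumℤ (rowEntries A i) ≡ + 0
    colSum   : ∀ j → sumℤ (colEntries A j) ≡ + 0

SMRExists : ℕ → ℕ → ℕ → ℕ → Set
SMRExists m n r s = Data.Product.Σ (PArray m n) (IsSMR m n r s)

-- Every rectangle below comes from a row system: m rows of r integers, each summing to zero
-- and with pairwise distinct absolute values, that together list ±1, …, ±n exactly once.
-- Putting each entry x in column |x| gives an SMR(m,n;r,2), every column being {x, -x}.
-- Row systems can be juxtaposed and stacked after adding the number of values of the first
-- to the absolute values of the second, which keeps row sums zero when the second one is
-- balanced (as many positive as negative entries in each row). Balanced systems with four
-- and six columns, m ≥ 2 resp. m ≥ 3, are stacked from five small examples; explicit
-- families with three and five columns exist for every even m, which mr = 2n forces when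
-- r is odd. Conversely a column needs two rows; a row of length one is (0) and a row
-- (a, -a) forces a = 0, so r ≥ 3 when m ≥ 3. For m = 2 the second row is the negative of
-- the first, so the absolute values in the first row add up to r(r+1)/2, which is twice
-- the sum of its negative entries: 4 divides r(r+1).

module Submission where

open import Defs
open import Data.Nat using (ℕ; _*_; _%_; _≥_; NonZero)
open import Data.Sum using (_⊎_)
open import Data.Product using (_×_)
open import Function.Bundles using (_⇔_)
open import Relation.Binary.PropositionalEquality using (_≡_)

open import Algebra.Bundles using (CommutativeMonoid; AbelianGroup)
open import Data.Empty using (⊥; ⊥-elim)
open import Data.Fin as Fin using (Fin; toℕ; #_)
import Data.Fin.Properties as FinP
open import Data.Integer as ℤ using (ℤ; +_; -_; -[1+_]; +[1+_]; ∣_∣)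
  renaming (_+_ to _+ℤ_; _-_ to _-ℤ_; _*_ to _*ℤ_)
import Data.Integer.Properties as ℤP
import Data.Integer.Tactic.RingSolver as ℤ-Solver
open import Data.List
  using (List; []; _∷_; _++_; _∷ʳ_; [_]; map; concat; filter; zipWith; length; lookup; allFin; applyUpTo;
         catMaybes; fromMaybe)
import Data.List.Properties as ListP
open import Data.List.Membership.Propositional using (_∈_; _∉_)
import Data.List.Membership.Propositional.Properties as ∈P
open import Data.List.Relation.Binary.Permutation.Propositional
  using (_↭_; prep; swap; ↭-refl; ↭-sym; ↭-trans; ↭-reflexive; ↭⇒↭ₛ; module PermutationReasoning)
import Data.List.Relation.Binary.Permutation.Propositional.Properties as ↭P
open import Data.List.Relation.Binary.Permutation.Setoid.Properties using (foldr-commMonoid; Unique-resp-↭)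
open import Data.List.Relation.Unary.All as All using (All; []; _∷_)
import Data.List.Relation.Unary.All.Properties as AllP
open import Data.List.Relation.Unary.AllPairs as AllPairs using (AllPairs; []; _∷_)
import Data.List.Relation.Unary.AllPairs.Properties as AllPairsP
open import Data.List.Relation.Unary.Any using (here; there)
open import Data.List.Relation.Unary.Linked using (Linked; []; [-]; _∷_)
import Data.List.Relation.Unary.Linked.Properties as LinkedP
open import Data.List.Relation.Unary.Unique.Propositional using (Unique)
import Data.List.Relation.Unary.Unique.Propositional.Properties as UniqueP
open import Data.Maybe as Maybe using (Maybe; just; nothing; from-just)
import Data.Maybe.Properties as MaybeP
open import Data.Nat as ℕ using (zero; suc; _+_; _≤_; _<_; z≤n; s≤s; _/_)
open import Data.Nat.DivMod using (m*n%n≡0; m*n/n≡m; [m+kn]%n≡m%n; m≡m%n+[m/n]*n; %-distribˡ-*; m%n<n)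
open import Data.Nat.ListAction using (sum)
import Data.Nat.ListAction.Properties as SumP
import Data.Nat.Properties as ℕP
import Data.Nat.Tactic.RingSolver as ℕ-Solver
open import Data.Product using (∃; ∃₂; _,_; proj₁; proj₂)
open import Data.Sum using (inj₁; inj₂)
open import Function using (_∘_)
open import Function.Bundles using (mk⇔)
open import Relation.Binary.PropositionalEquality
  using (_≢_; refl; sym; trans; cong; cong₂; subst; setoid; module ≡-Reasoning)
open import Relation.Nullary using (yes; no; ¬_; ¬?; contradiction)

open import Algebra.Properties.CommutativeSemigroup
  (CommutativeMonoid.commutativeSemigroup (↭P.++-commutativeMonoid {A = ℤ}))
  using () renaming (interchange to ++-interchange)
open import Algebra.Properties.CommutativeSemigroup ℕP.+-commutativeSemigroup
  using () renaming (x∙yz≈y∙xz to +-leftComm)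
open import Algebra.Properties.Group (AbelianGroup.group ℤP.+-0-abelianGroup)
  using (inverseʳ-unique)
open import Algebra.Solver.CommutativeMonoid (↭P.++-commutativeMonoid {A = ℤ})
  using (solve; _⊜_; _⊕_)

run : ∀ {A : Set} → (ℕ → A) → ℕ → ℕ → List A
run f a zero    = []
run f a (suc c) = f a ∷ run f (suc a) c

posRun negRun : ℕ → ℕ → List ℤ
posRun = run (λ i → +[1+ i ])
negRun = run (λ i → -[1+ i ])

signedRun : ℕ → List ℤ
signedRun n = posRun 0 n ++ negRun 0 n

negRunDown : ℕ → List ℤ
negRunDown zero    = []
negRunDown (suc l) = -[1+ l ] ∷ negRunDown l

module _ {A : Set} (f : ℕ → A) where

  run-+ : ∀ a c₁ c₂ → run f a (c₁ + c₂) ≡ run f a c₁ ++ run f (a + c₁) c₂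
  run-+ a zero     c₂ rewrite ℕP.+-identityʳ a = refl
  run-+ a (suc c₁) c₂ rewrite run-+ (suc a) c₁ c₂ | ℕP.+-suc a c₁ = refl

  run-suc : ∀ a c → run f a (suc c) ≡ run f a c ∷ʳ f (a + c)
  run-suc a c = trans (cong (run f a) (ℕP.+-comm 1 c)) (run-+ a c 1)

  map-run : ∀ {B : Set} (g : A → B) a c → map g (run f a c) ≡ run (g ∘ f) a c
  map-run g a zero    = refl
  map-run g a (suc c) = cong (g (f a) ∷_) (map-run g (suc a) c)

  map-run-shift : ∀ (g : A → A) s → (∀ i → g (f i) ≡ f (i + s)) →
                  ∀ a c → map g (run f a c) ≡ run f (a + s) c
  map-run-shift g s g∘f≡ a zero    = refl
  map-run-shift g s g∘f≡ a (suc c) = cong₂ _∷_ (g∘f≡ a) (map-run-shift g s g∘f≡ (suc a) c)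

length-run : ∀ {A : Set} (f : ℕ → A) a c → length (run f a c) ≡ c
length-run f a zero    = refl
length-run f a (suc c) = cong suc (length-run f (suc a) c)

run-suc-start : ∀ {A : Set} (f : ℕ → A) a c → run f (suc a) c ≡ run (f ∘ suc) a c
run-suc-start f a zero    = refl
run-suc-start f a (suc c) = cong (f (suc a) ∷_) (run-suc-start f (suc a) c)

run≡applyUpTo : ∀ {A : Set} (f : ℕ → A) c → run f 0 c ≡ applyUpTo f c
run≡applyUpTo f zero    = refl
run≡applyUpTo f (suc c) = cong (f 0 ∷_) (trans (run-suc-start f 0 c) (run≡applyUpTo (f ∘ suc) c))

pmUpTo≡signedRun : ∀ k → pmUpTo k ≡ signedRun k
pmUpTo≡signedRun k = begin
  posUpTo k ++ map -_ (posUpTo k)     ≡⟨ cong (λ xs → xs ++ map -_ xs) posUpTo≡posRun ⟩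
  posRun 0 k ++ map -_ (posRun 0 k)   ≡⟨ cong (posRun 0 k ++_) (map-run _ -_ 0 k) ⟩
  signedRun k                         ∎
  where
  open ≡-Reasoning
  posUpTo≡posRun : posUpTo k ≡ posRun 0 k
  posUpTo≡posRun = trans (ListP.map-upTo (λ i → + suc i) k) (sym (run≡applyUpTo _ k))

symSet-double : ∀ n → symSet (n * 2) ≡ signedRun n
symSet-double n = begin
  symSet (n * 2)         ≡⟨ symSet-even (n * 2) (m*n%n≡0 n 2) ⟩
  pmUpTo (n * 2 / 2)     ≡⟨ cong pmUpTo (m*n/n≡m n 2) ⟩
  pmUpTo n               ≡⟨ pmUpTo≡signedRun n ⟩
  signedRun n            ∎
  where
  open ≡-Reasoning
  symSet-even : ∀ N → N % 2 ≡ 0 → symSet N ≡ pmUpTo (N / 2)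
  symSet-even N N%2≡0 rewrite N%2≡0 = refl

negRunDown↭negRun : ∀ l → negRunDown l ↭ negRun 0 l
negRunDown↭negRun zero    = ↭-refl
negRunDown↭negRun (suc l) = begin
  -[1+ l ] ∷ negRunDown l   ↭⟨ prep -[1+ l ] (negRunDown↭negRun l) ⟩
  -[1+ l ] ∷ negRun 0 l     ↭⟨ ↭P.∷↭∷ʳ -[1+ l ] (negRun 0 l) ⟩
  negRun 0 l ∷ʳ -[1+ l ]    ≡⟨ run-suc _ 0 l ⟨
  negRun 0 (suc l)          ∎
  where open PermutationReasoning

shiftAbs : ℕ → ℤ → ℤ
shiftAbs s (+ k)    = + (k + s)
shiftAbs s -[1+ k ] = -[1+ k + s ]

∣shiftAbs∣ : ∀ s x → ∣ shiftAbs s x ∣ ≡ ∣ x ∣ + s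
∣shiftAbs∣ s (+ k)    = refl
∣shiftAbs∣ s -[1+ k ] = refl

signedRun-+ : ∀ n₁ n₂ → signedRun (n₁ + n₂) ↭ signedRun n₁ ++ map (shiftAbs n₁) (signedRun n₂)
signedRun-+ n₁ n₂ = begin
  signedRun (n₁ + n₂)
    ≡⟨ cong₂ _++_ (run-+ _ 0 n₁ n₂) (run-+ _ 0 n₁ n₂) ⟩
  (posRun 0 n₁ ++ posRun n₁ n₂) ++ (negRun 0 n₁ ++ negRun n₁ n₂)
    ↭⟨ ++-interchange (posRun 0 n₁) (posRun n₁ n₂) (negRun 0 n₁) (negRun n₁ n₂) ⟩
  signedRun n₁ ++ (posRun n₁ n₂ ++ negRun n₁ n₂)
    ≡⟨ cong (signedRun n₁ ++_) shifted ⟨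
  signedRun n₁ ++ map (shiftAbs n₁) (signedRun n₂) ∎
  where
  open PermutationReasoning
  shifted : map (shiftAbs n₁) (signedRun n₂) ≡ posRun n₁ n₂ ++ negRun n₁ n₂
  shifted = trans (ListP.map-++ (shiftAbs n₁) (posRun 0 n₂) (negRun 0 n₂))
    (cong₂ _++_ (map-run-shift _ (shiftAbs n₁) n₁ (λ _ → refl) 0 n₂)
                (map-run-shift _ (shiftAbs n₁) n₁ (λ _ → refl) 0 n₂))

sumℤ-++ : ∀ xs ys → sumℤ (xs ++ ys) ≡ sumℤ xs +ℤ sumℤ ys
sumℤ-++ []       ys = sym (ℤP.+-identityˡ _)
sumℤ-++ (x ∷ xs) ys = trans (cong (x +ℤ_) (sumℤ-++ xs ys)) (sym (ℤP.+-assoc x _ _))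

sumℤ-↭ : ∀ {xs ys} → xs ↭ ys → sumℤ xs ≡ sumℤ ys
sumℤ-↭ p = foldr-commMonoid ℤ+.setoid ℤ+.isCommutativeMonoid (↭⇒↭ₛ p)
  where module ℤ+ = CommutativeMonoid ℤP.+-0-commutativeMonoid

-- 0 counts as positive, in accordance with shiftAbs s (+ 0) ≡ + s.
sgn : ℤ → ℤ
sgn (+ _)    = + 1
sgn -[1+ _ ] = - + 1

balance : List ℤ → ℤ
balance xs = sumℤ (map sgn xs)

Balanced : List ℤ → Set
Balanced xs = balance xs ≡ + 0

shiftAbs≡+sgn : ∀ s x → shiftAbs s x ≡ x +ℤ + s *ℤ sgn x
shiftAbs≡+sgn s (+ k)    = trans (ℤP.pos-+ k s) (cong (+ k +ℤ_) (sym (ℤP.*-identityʳ (+ s))))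
shiftAbs≡+sgn s -[1+ k ] = trans (cong -_ (ℤP.pos-+ (suc k) s))
  (trans (ℤP.neg-distrib-+ +[1+ k ] (+ s)) (cong (-[1+ k ] +ℤ_) (minus-one (+ s))))
  where
  minus-one : ∀ a → - a ≡ a *ℤ (- + 1)
  minus-one = ℤ-Solver.solve-∀

sumℤ-map-shiftAbs : ∀ s xs → sumℤ (map (shiftAbs s) xs) ≡ sumℤ xs +ℤ + s *ℤ balance xs
sumℤ-map-shiftAbs s []       = sym (trans (ℤP.+-identityˡ _) (ℤP.*-zeroʳ (+ s)))
sumℤ-map-shiftAbs s (x ∷ xs) rewrite shiftAbs≡+sgn s x | sumℤ-map-shiftAbs s xs =
  regroup x (+ s) (sgn x) (sumℤ xs) (balance xs)
  where
  regroup : ∀ x s g S B → (x +ℤ s *ℤ g) +ℤ (S +ℤ s *ℤ B) ≡ (x +ℤ S) +ℤ s *ℤ (g +ℤ B)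
  regroup = ℤ-Solver.solve-∀

balance-map-shiftAbs : ∀ s xs → balance (map (shiftAbs s) xs) ≡ balance xs
balance-map-shiftAbs s xs = cong sumℤ (trans (sym (ListP.map-∘ xs)) (ListP.map-cong sgn-shiftAbs xs))
  where
  sgn-shiftAbs : ∀ x → sgn (shiftAbs s x) ≡ sgn x
  sgn-shiftAbs (+ _)    = refl
  sgn-shiftAbs -[1+ _ ] = refl

sumℤ-map-shiftAbs-balanced : ∀ s xs → sumℤ xs ≡ + 0 → Balanced xs → sumℤ (map (shiftAbs s) xs) ≡ + 0
sumℤ-map-shiftAbs-balanced s xs sum≡0 bal≡0 rewrite sumℤ-map-shiftAbs s xs | sum≡0 | bal≡0 =
  trans (ℤP.+-identityˡ _) (ℤP.*-zeroʳ (+ s))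

posPart negPart : List ℤ → ℕ
posPart []            = 0
posPart (+ k ∷ xs)    = k + posPart xs
posPart (-[1+ k ] ∷ xs) = posPart xs
negPart []            = 0
negPart (+ k ∷ xs)    = negPart xs
negPart (-[1+ k ] ∷ xs) = suc k + negPart xs

sumℤ≡posPart-negPart : ∀ xs → sumℤ xs ≡ + posPart xs -ℤ + negPart xs
sumℤ≡posPart-negPart [] = refl
sumℤ≡posPart-negPart (+ k ∷ xs)
  rewrite sumℤ≡posPart-negPart xs | ℤP.pos-+ k (posPart xs) = lemma (+ k) (+ posPart xs) (+ negPart xs)
  where
  lemma : ∀ x p n → x +ℤ (p -ℤ n) ≡ (x +ℤ p) -ℤ n
  lemma = ℤ-Solver.solve-∀
sumℤ≡posPart-negPart (-[1+ k ] ∷ xs)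
  rewrite sumℤ≡posPart-negPart xs | ℤP.pos-+ (suc k) (negPart xs) = lemma (+ suc k) (+ posPart xs) (+ negPart xs)
  where
  lemma : ∀ x p n → - x +ℤ (p -ℤ n) ≡ p -ℤ (x +ℤ n)
  lemma = ℤ-Solver.solve-∀

posPart≡negPart⇒sumℤ≡0 : ∀ xs → posPart xs ≡ negPart xs → sumℤ xs ≡ + 0
posPart≡negPart⇒sumℤ≡0 xs eq rewrite sumℤ≡posPart-negPart xs | eq = ℤP.+-inverseʳ (+ negPart xs)

sumℤ≡0⇒posPart≡negPart : ∀ xs → sumℤ xs ≡ + 0 → posPart xs ≡ negPart xs
sumℤ≡0⇒posPart≡negPart xs sum≡0 =
  ℤP.+-injective (ℤP.i-j≡0⇒i≡j (+ posPart xs) (+ negPart xs) (trans (sym (sumℤ≡posPart-negPart xs)) sum≡0))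

DistinctAbs : List ℤ → Set
DistinctAbs = AllPairs (λ x y → ∣ x ∣ ≢ ∣ y ∣)

increasingAbs⇒distinctAbs : ∀ {xs} → Linked (λ x y → ∣ x ∣ < ∣ y ∣) xs → DistinctAbs xs
increasingAbs⇒distinctAbs l = AllPairs.map ℕP.<⇒≢ (LinkedP.Linked⇒AllPairs ℕP.<-trans l)

distinctAbs-map-shiftAbs : ∀ s {xs} → DistinctAbs xs → DistinctAbs (map (shiftAbs s) xs)
distinctAbs-map-shiftAbs s = AllPairsP.map⁺ ∘ AllPairs.map λ {x} {y} ∣x∣≢∣y∣ eq →
  ∣x∣≢∣y∣ (ℕP.+-cancelʳ-≡ s _ _ (trans (sym (∣shiftAbs∣ s x)) (trans eq (∣shiftAbs∣ s y))))

distinctAbs-++-shiftAbs : ∀ s {xs ys} → DistinctAbs xs → DistinctAbs ys →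
  All (λ x → ∣ x ∣ ≤ s) xs → All (λ y → 1 ≤ ∣ y ∣) ys → DistinctAbs (xs ++ map (shiftAbs s) ys)
distinctAbs-++-shiftAbs s dxs dys xs≤s 1≤ys = AllPairsP.++⁺ dxs (distinctAbs-map-shiftAbs s dys)
  (All.map (λ {x} ∣x∣≤s → AllP.map⁺ (All.map (λ {y} 1≤∣y∣ eq →
    ℕP.<⇒≢ (ℕP.≤-<-trans ∣x∣≤s (ℕP.+-monoˡ-≤ s 1≤∣y∣)) (trans eq (∣shiftAbs∣ s y))) 1≤ys)) xs≤s)

entryWithAbs : List ℤ → ℕ → Maybe ℤ
entryWithAbs []       k = nothing
entryWithAbs (x ∷ xs) k with ∣ x ∣ ℕ.≟ k
... | yes _ = just x
... | no  _ = entryWithAbs xs k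

withAbs : ℕ → List ℤ → List ℤ
withAbs k = filter (λ y → ∣ y ∣ ℕ.≟ k)

entryWithAbs-∉ : ∀ {k} xs → All (λ y → ∣ y ∣ ≢ k) xs → entryWithAbs xs k ≡ nothing
entryWithAbs-∉     []       []                = refl
entryWithAbs-∉ {k} (x ∷ xs) (∣x∣≢k ∷ ∣xs∣≢k) with ∣ x ∣ ℕ.≟ k
... | yes ∣x∣≡k = ⊥-elim (∣x∣≢k ∣x∣≡k)
... | no  _     = entryWithAbs-∉ xs ∣xs∣≢k

entryWithAbs-head : ∀ x xs → entryWithAbs (x ∷ xs) ∣ x ∣ ≡ just x
entryWithAbs-head x xs with ∣ x ∣ ℕ.≟ ∣ x ∣
... | yes _     = refl
... | no  ∣x∣≢∣x∣ = ⊥-elim (∣x∣≢∣x∣ refl)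

map-entryWithAbs-∷ : ∀ x xs ks → All (∣ x ∣ ≢_) ks → map (entryWithAbs (x ∷ xs)) ks ≡ map (entryWithAbs xs) ks
map-entryWithAbs-∷ x xs []       []             = refl
map-entryWithAbs-∷ x xs (k ∷ ks) (∣x∣≢k ∷ ∣x∣≢ks) with ∣ x ∣ ℕ.≟ k
... | yes ∣x∣≡k = ⊥-elim (∣x∣≢k ∣x∣≡k)
... | no  _     = cong (entryWithAbs xs k ∷_) (map-entryWithAbs-∷ x xs ks ∣x∣≢ks)

fromMaybe-entryWithAbs : ∀ xs k → DistinctAbs xs → fromMaybe (entryWithAbs xs k) ≡ withAbs k xs
fromMaybe-entryWithAbs []       k _ = refl
fromMaybe-entryWithAbs (x ∷ xs) k (∣x∣≢∣xs∣ ∷ dxs) with ∣ x ∣ ℕ.≟ k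
... | yes ∣x∣≡k = sym (trans (ListP.filter-accept (λ y → ∣ y ∣ ℕ.≟ k) {x} {xs} ∣x∣≡k)
  (cong (x ∷_) (ListP.filter-none (λ y → ∣ y ∣ ℕ.≟ k) (All.map (λ ne eq → ne (trans ∣x∣≡k (sym eq))) ∣x∣≢∣xs∣))))
... | no  ∣x∣≢k = trans (fromMaybe-entryWithAbs xs k dxs) (sym (ListP.filter-reject (λ y → ∣ y ∣ ℕ.≟ k) {x} {xs} ∣x∣≢k))

Unique-++-∷⁻ : ∀ {k : ℕ} ks₁ ks₂ → Unique (ks₁ ++ k ∷ ks₂) → All (k ≢_) ks₁ × All (k ≢_) ks₂
Unique-++-∷⁻ []        ks₂ (k∉ks₂ ∷ _) = [] , k∉ks₂
Unique-++-∷⁻ (k₁ ∷ ks₁) ks₂ (k₁∉ ∷ u) with Unique-++-∷⁻ ks₁ ks₂ u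
... | k∉ks₁ , k∉ks₂ = ((λ eq → All.head (AllP.++⁻ʳ ks₁ k₁∉) (sym eq)) ∷ k∉ks₁) , k∉ks₂

catMaybes-map-++-∷ : ∀ (f : ℕ → Maybe ℤ) ks₁ k ks₂ →
  catMaybes (map f (ks₁ ++ k ∷ ks₂)) ≡ catMaybes (map f ks₁) ++ fromMaybe (f k) ++ catMaybes (map f ks₂)
catMaybes-map-++-∷ f ks₁ k ks₂ rewrite ListP.map-++ f ks₁ (k ∷ ks₂)
  | ListP.catMaybes-++ (map f ks₁) (map f (k ∷ ks₂)) with f k
... | just _  = refl
... | nothing = refl

catMaybes-map-entryWithAbs : ∀ xs ks → Unique ks → DistinctAbs xs → All (λ x → ∣ x ∣ ∈ ks) xs →
  catMaybes (map (entryWithAbs xs) ks) ↭ xs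
catMaybes-map-entryWithAbs [] ks _ _ _ = ↭-reflexive (nothings ks)
  where
  nothings : ∀ ks → catMaybes (map (entryWithAbs []) ks) ≡ []
  nothings []       = refl
  nothings (_ ∷ ks) = nothings ks
catMaybes-map-entryWithAbs (x ∷ xs) ks uks (∣x∣∉ ∷ dxs) (∣x∣∈ ∷ ∣xs∣∈) with ∈P.∈-∃++ ∣x∣∈
... | ks₁ , ks₂ , refl with Unique-++-∷⁻ ks₁ ks₂ uks
... | ∣x∣∉ks₁ , ∣x∣∉ks₂ = begin
  catMaybes (map (entryWithAbs (x ∷ xs)) (ks₁ ++ ∣ x ∣ ∷ ks₂))
    ≡⟨ catMaybes-map-++-∷ (entryWithAbs (x ∷ xs)) ks₁ ∣ x ∣ ks₂ ⟩
  C (x ∷ xs) ks₁ ++ fromMaybe (entryWithAbs (x ∷ xs) ∣ x ∣) ++ C (x ∷ xs) ks₂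
    ≡⟨ cong₂ (λ a c → catMaybes a ++ fromMaybe (entryWithAbs (x ∷ xs) ∣ x ∣) ++ catMaybes c)
             (map-entryWithAbs-∷ x xs ks₁ ∣x∣∉ks₁) (map-entryWithAbs-∷ x xs ks₂ ∣x∣∉ks₂) ⟩
  C xs ks₁ ++ fromMaybe (entryWithAbs (x ∷ xs) ∣ x ∣) ++ C xs ks₂
    ≡⟨ cong (λ e → C xs ks₁ ++ fromMaybe e ++ C xs ks₂) (entryWithAbs-head x xs) ⟩
  C xs ks₁ ++ x ∷ C xs ks₂
    ↭⟨ ↭P.shift x (C xs ks₁) (C xs ks₂) ⟩
  x ∷ (C xs ks₁ ++ C xs ks₂)
    ≡⟨ cong (λ e → x ∷ (C xs ks₁ ++ fromMaybe e ++ C xs ks₂)) (entryWithAbs-∉ xs (All.map (_∘ sym) ∣x∣∉)) ⟨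
  x ∷ (C xs ks₁ ++ fromMaybe (entryWithAbs xs ∣ x ∣) ++ C xs ks₂)
    ≡⟨ cong (x ∷_) (catMaybes-map-++-∷ (entryWithAbs xs) ks₁ ∣ x ∣ ks₂) ⟨
  x ∷ C xs (ks₁ ++ ∣ x ∣ ∷ ks₂)
    ↭⟨ prep x (catMaybes-map-entryWithAbs xs _ uks dxs ∣xs∣∈) ⟩
  x ∷ xs ∎
  where
  open PermutationReasoning
  C : List ℤ → List ℕ → List ℤ
  C ys ks = catMaybes (map (entryWithAbs ys) ks)

module _ (f : ℕ → ℤ) (∣f∣ : ∀ i → ∣ f i ∣ ≡ suc i) where

  withAbs-run-below : ∀ t a c → t < a → withAbs (suc t) (run f a c) ≡ []
  withAbs-run-below t a zero    t<a = refl
  withAbs-run-below t a (suc c) t<a = trans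
    (ListP.filter-reject (λ y → ∣ y ∣ ℕ.≟ suc t) {f a} {run f (suc a) c}
      (λ eq → ℕP.<⇒≢ t<a (sym (ℕP.suc-injective (trans (sym (∣f∣ a)) eq)))))
    (withAbs-run-below t (suc a) c (ℕP.m<n⇒m<1+n t<a))

  withAbs-run : ∀ t a c → a ≤ t → t < a + c → withAbs (suc t) (run f a c) ≡ [ f t ]
  withAbs-run t a zero    a≤t t<a+0 = ⊥-elim (ℕP.<⇒≱ (subst (t <_) (ℕP.+-identityʳ a) t<a+0) a≤t)
  withAbs-run t a (suc c) a≤t t<a+1+c with a ℕ.≟ t
  ... | yes refl = trans (ListP.filter-accept (λ y → ∣ y ∣ ℕ.≟ suc t) {f t} {run f (suc t) c} (∣f∣ t))
    (cong (f t ∷_) (withAbs-run-below t (suc t) c (ℕP.n<1+n t)))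
  ... | no  a≢t  = trans
    (ListP.filter-reject (λ y → ∣ y ∣ ℕ.≟ suc t) {f a} {run f (suc a) c}
      (λ eq → a≢t (ℕP.suc-injective (trans (sym (∣f∣ a)) eq))))
    (withAbs-run t (suc a) c (ℕP.≤∧≢⇒< a≤t a≢t) (subst (t <_) (ℕP.+-suc a c) t<a+1+c))

  ∈-run⁻ : ∀ {x} c → x ∈ run f 0 c → ∃ λ t → t < c × ∣ x ∣ ≡ suc t
  ∈-run⁻ c x∈ with ∈P.∈-applyUpTo⁻ f (subst (_ ∈_) (run≡applyUpTo f c) x∈)
  ... | t , t<c , refl = t , t<c , ∣f∣ t

withAbs-signedRun : ∀ t n → t < n → withAbs (suc t) (signedRun n) ≡ +[1+ t ] ∷ -[1+ t ] ∷ []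
withAbs-signedRun t n t<n = trans (ListP.filter-++ (λ y → ∣ y ∣ ℕ.≟ suc t) (posRun 0 n) (negRun 0 n))
  (cong₂ _++_ (withAbs-run _ (λ _ → refl) t 0 n z≤n t<n) (withAbs-run _ (λ _ → refl) t 0 n z≤n t<n))

∈signedRun⁻ : ∀ {x} n → x ∈ signedRun n → ∃ λ t → t < n × ∣ x ∣ ≡ suc t
∈signedRun⁻ n x∈ with ∈P.∈-++⁻ (posRun 0 n) x∈
... | inj₁ x∈pos = ∈-run⁻ _ (λ _ → refl) n x∈pos
... | inj₂ x∈neg = ∈-run⁻ _ (λ _ → refl) n x∈neg

m*2≡m+m : ∀ m → m * 2 ≡ m + m
m*2≡m+m = ℕ-Solver.solve-∀

length-signedRun : ∀ n → length (signedRun n) ≡ n * 2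
length-signedRun n = begin
  length (posRun 0 n ++ negRun 0 n)   ≡⟨ ListP.length-++ (posRun 0 n) ⟩
  length (posRun 0 n) + length (negRun 0 n) ≡⟨ cong₂ _+_ (length-run _ 0 n) (length-run _ 0 n) ⟩
  n + n                               ≡⟨ m*2≡m+m n ⟨
  n * 2                               ∎
  where open ≡-Reasoning

length-concat-uniform : ∀ {r} (xss : List (List ℤ)) → All (λ xs → length xs ≡ r) xss →
  length (concat xss) ≡ length xss * r
length-concat-uniform []         []        = refl
length-concat-uniform (xs ∷ xss) (ℓ ∷ ℓs) =
  trans (ListP.length-++ xs) (cong₂ _+_ ℓ (length-concat-uniform xss ℓs))

withAbs-concat : ∀ k (xss : List (List ℤ)) → concat (map (withAbs k) xss) ≡ withAbs k (concat xss)
withAbs-concat k []         = refl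
withAbs-concat k (xs ∷ xss) = trans (cong (withAbs k xs ++_) (withAbs-concat k xss))
  (sym (ListP.filter-++ (λ y → ∣ y ∣ ℕ.≟ k) xs (concat xss)))

concat-map⁺ : ∀ {I : Set} {f g : I → List ℤ} is → (∀ i → f i ↭ g i) → concat (map f is) ↭ concat (map g is)
concat-map⁺ []       f↭g = ↭-refl
concat-map⁺ (i ∷ is) f↭g = ↭P.++⁺ (f↭g i) (concat-map⁺ is f↭g)

map-lookup-allFin : ∀ {A : Set} (xs : List A) → map (lookup xs) (allFin (length xs)) ≡ xs
map-lookup-allFin xs = trans (ListP.map-tabulate (λ i → i) (lookup xs)) (ListP.tabulate-lookup xs)

-- An SMR(m,n;r,2) given row by row: the entry x of a row is placed in column ∣x∣ ∸ 1,
-- so column t receives exactly the two entries ±(t+1).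
record RowSystem (m r n : ℕ) : Set where
  field
    rows            : List (List ℤ)
    length-rows     : length rows ≡ m
    length-row      : All (λ xs → length xs ≡ r) rows
    sum-row         : All (λ xs → sumℤ xs ≡ + 0) rows
    distinctAbs-row : All DistinctAbs rows
    concat-rows     : concat rows ↭ signedRun n

  ∈rows⁻ : ∀ {xs x} → xs ∈ rows → x ∈ xs → ∃ λ t → t < n × ∣ x ∣ ≡ suc t
  ∈rows⁻ xs∈ x∈ = ∈signedRun⁻ n (↭P.∈-resp-↭ concat-rows (∈P.∈-concat⁺′ x∈ xs∈))

  absInRange : All (All (λ x → 1 ≤ ∣ x ∣ × ∣ x ∣ ≤ n)) rows
  absInRange = All.tabulate λ xs∈ → All.tabulate λ {x} x∈ → inRange {x} (∈rows⁻ xs∈ x∈)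
    where
    inRange : ∀ {x} → ∃ (λ t → t < n × ∣ x ∣ ≡ suc t) → 1 ≤ ∣ x ∣ × ∣ x ∣ ≤ n
    inRange (t , t<n , ∣x∣≡1+t) rewrite ∣x∣≡1+t = s≤s z≤n , t<n

  card : m * r ≡ n * 2
  card = begin
    m * r                ≡⟨ cong (_* r) length-rows ⟨
    length rows * r      ≡⟨ length-concat-uniform rows length-row ⟨
    length (concat rows) ≡⟨ ↭P.↭-length concat-rows ⟩
    length (signedRun n) ≡⟨ length-signedRun n ⟩
    n * 2                ∎
    where open ≡-Reasoning

module Placement {m r n} (S : RowSystem m r n) where
  open RowSystem S

  array : PArray (length rows) n
  array i j = entryWithAbs (lookup rows i) (suc (toℕ j))

  rowEntries-array : ∀ i → rowEntries array i ↭ lookup rows i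
  rowEntries-array i = begin
    catMaybes (map (λ j → entryWithAbs R (suc (toℕ j))) (allFin n))
      ≡⟨ cong catMaybes (ListP.map-∘ (allFin n)) ⟩
    catMaybes (map (entryWithAbs R) columnKeys)
      ↭⟨ catMaybes-map-entryWithAbs R columnKeys unique (All.lookup distinctAbs-row R∈) (All.tabulate covered) ⟩
    R ∎
    where
    open PermutationReasoning
    R = lookup rows i
    R∈ = ∈P.∈-lookup i
    columnKeys = map (suc ∘ toℕ) (allFin n)
    unique : Unique columnKeys
    unique = UniqueP.map⁺ (FinP.toℕ-injective ∘ ℕP.suc-injective) (UniqueP.allFin⁺ n)
    covered : ∀ {x} → x ∈ R → ∣ x ∣ ∈ columnKeys
    covered x∈ with ∈rows⁻ R∈ x∈
    ... | t , t<n , ∣x∣≡1+t = subst (_∈ columnKeys) (trans (cong suc (FinP.toℕ-fromℕ< t<n)) (sym ∣x∣≡1+t))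
      (∈P.∈-map⁺ (suc ∘ toℕ) (∈P.∈-allFin (Fin.fromℕ< t<n)))

  colEntries-array : ∀ j → colEntries array j ↭ +[1+ toℕ j ] ∷ -[1+ toℕ j ] ∷ []
  colEntries-array j = begin
    catMaybes (map (λ i → array i j) is)
      ≡⟨ ListP.catMaybes-concatMap (map (λ i → array i j) is) ⟩
    concat (map fromMaybe (map (λ i → array i j) is))
      ≡⟨ cong concat (ListP.map-∘ is) ⟨
    concat (map (λ i → fromMaybe (array i j)) is)
      ≡⟨ cong concat (ListP.map-cong (λ i → fromMaybe-entryWithAbs _ k (All.lookup distinctAbs-row (∈P.∈-lookup i))) is) ⟩
    concat (map (λ i → withAbs k (lookup rows i)) is)
      ≡⟨ cong concat (trans (ListP.map-∘ is) (cong (map (withAbs k)) (map-lookup-allFin rows))) ⟩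
    concat (map (withAbs k) rows)
      ≡⟨ withAbs-concat k rows ⟩
    withAbs k (concat rows)
      ↭⟨ ↭P.filter-↭ (λ y → ∣ y ∣ ℕ.≟ k) concat-rows ⟩
    withAbs k (signedRun n)
      ≡⟨ withAbs-signedRun (toℕ j) n (FinP.toℕ<n j) ⟩
    +[1+ toℕ j ] ∷ -[1+ toℕ j ] ∷ [] ∎
    where
    open PermutationReasoning
    k  = suc (toℕ j)
    is = allFin (length rows)

  allEntries-array : allEntries array ↭ signedRun n
  allEntries-array = begin
    concat (map (rowEntries array) (allFin (length rows)))   ↭⟨ concat-map⁺ (allFin (length rows)) rowEntries-array ⟩
    concat (map (lookup rows) (allFin (length rows)))        ≡⟨ cong concat (map-lookup-allFin rows) ⟩
    concat rows                                              ↭⟨ concat-rows ⟩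
    signedRun n                                              ∎
    where open PermutationReasoning

rowSystem⇒SMR : ∀ {m r n} → RowSystem m r n → SMRExists m n r 2
rowSystem⇒SMR {r = r} {n} S@record { length-rows = refl } = array , record
  { rowCount = λ i → trans (↭P.↭-length (rowEntries-array i)) (All.lookup length-row (∈P.∈-lookup i))
  ; colCount = λ j → ↭P.↭-length (colEntries-array j)
  ; cardEq   = card
  ; entries  = subst (allEntries array ↭_) (sym (trans (cong symSet card) (symSet-double n))) allEntries-array
  ; rowSum   = λ i → trans (sumℤ-↭ (rowEntries-array i)) (All.lookup sum-row (∈P.∈-lookup i))
  ; colSum   = λ j → trans (sumℤ-↭ (colEntries-array j)) (sum-±[1+ toℕ j ])
  }
  where
  open RowSystem S
  open Placement S
  sum-±[1+_] : ∀ t → sumℤ (+[1+ t ] ∷ -[1+ t ] ∷ []) ≡ + 0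
  sum-±[1+ t ] = trans (cong (+[1+ t ] +ℤ_) (ℤP.+-identityʳ -[1+ t ])) (ℤP.+-inverseʳ +[1+ t ])

-- Combining row systems

record BalancedRowSystem (m r n : ℕ) : Set where
  field
    system       : RowSystem m r n
    balanced-row : All Balanced (RowSystem.rows system)
  open RowSystem system public

open BalancedRowSystem using (system)

All-zipWith⁺ : ∀ {A B C : Set} {P : A → Set} {Q : B → Set} {R : C → Set} (f : A → B → C) →
  (∀ {a b} → P a → Q b → R (f a b)) → ∀ {as bs} → All P as → All Q bs → All R (zipWith f as bs)
All-zipWith⁺ f g []       _        = []
All-zipWith⁺ f g (_ ∷ _)  []       = []
All-zipWith⁺ f g (p ∷ ps) (q ∷ qs) = g p q ∷ All-zipWith⁺ f g ps qs

concat-zipWith-++ : ∀ (xss yss : List (List ℤ)) → length xss ≡ length yss →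
  concat (zipWith _++_ xss yss) ↭ concat xss ++ concat yss
concat-zipWith-++ []         []         _  = ↭-refl
concat-zipWith-++ (xs ∷ xss) (ys ∷ yss) eq = ↭-trans
  (↭P.++⁺ˡ (xs ++ ys) (concat-zipWith-++ xss yss (ℕP.suc-injective eq)))
  (++-interchange xs ys (concat xss) (concat yss))

concat-shifted : ∀ xss yss {n₁ n₂} → concat xss ↭ signedRun n₁ → concat yss ↭ signedRun n₂ →
  concat xss ++ concat (map (map (shiftAbs n₁)) yss) ↭ signedRun (n₁ + n₂)
concat-shifted xss yss {n₁} {n₂} xss↭ yss↭ = begin
  concat xss ++ concat (map (map (shiftAbs n₁)) yss)   ≡⟨ cong (concat xss ++_) (ListP.concat-map yss) ⟩
  concat xss ++ map (shiftAbs n₁) (concat yss)         ↭⟨ ↭P.++⁺ xss↭ (↭P.map⁺ (shiftAbs n₁) yss↭) ⟩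
  signedRun n₁ ++ map (shiftAbs n₁) (signedRun n₂)     ↭⟨ signedRun-+ n₁ n₂ ⟨
  signedRun (n₁ + n₂)                                  ∎
  where open PermutationReasoning

juxtapose : ∀ {m r₁ r₂ n₁ n₂} → RowSystem m r₁ n₁ → BalancedRowSystem m r₂ n₂ → RowSystem m (r₁ + r₂) (n₁ + n₂)
juxtapose {m} {n₁ = n₁} {n₂} S B = record
  { rows            = zipWith _⧺_ S.rows B.rows
  ; length-rows     = trans (ListP.length-zipWith _⧺_ S.rows B.rows)
                        (trans (cong₂ ℕ._⊓_ S.length-rows B.length-rows) (ℕP.⊓-idem m))
  ; length-row      = All-zipWith⁺ _⧺_ (λ {xs} {ys} ℓxs ℓys →
                        trans (ListP.length-++ xs) (cong₂ _+_ ℓxs (trans (ListP.length-map _ ys) ℓys)))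
                        S.length-row B.length-row
  ; sum-row         = All-zipWith⁺ _⧺_ (λ {xs} {ys} Σxs (Σys , bys) →
                        trans (sumℤ-++ xs _) (cong₂ _+ℤ_ Σxs (sumℤ-map-shiftAbs-balanced n₁ ys Σys bys)))
                        S.sum-row (All.zip (B.sum-row , B.balanced-row))
  ; distinctAbs-row = All-zipWith⁺ _⧺_ (λ (dxs , xs∈) (dys , ys∈) →
                        distinctAbs-++-shiftAbs n₁ dxs dys (All.map proj₂ xs∈) (All.map proj₁ ys∈))
                        (All.zip (S.distinctAbs-row , S.absInRange)) (All.zip (B.distinctAbs-row , B.absInRange))
  ; concat-rows     = begin
      concat (zipWith _⧺_ S.rows B.rows)
        ≡⟨ cong concat zipWith-⧺ ⟩
      concat (zipWith _++_ S.rows shifted)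
        ↭⟨ concat-zipWith-++ S.rows shifted (trans S.length-rows (sym length-shifted)) ⟩
      concat S.rows ++ concat shifted
        ↭⟨ concat-shifted S.rows B.rows S.concat-rows B.concat-rows ⟩
      signedRun (n₁ + n₂) ∎
  }
  where
  module S = RowSystem S
  module B = BalancedRowSystem B
  open PermutationReasoning
  _⧺_ : List ℤ → List ℤ → List ℤ
  xs ⧺ ys = xs ++ map (shiftAbs n₁) ys
  shifted = map (map (shiftAbs n₁)) B.rows
  length-shifted : length shifted ≡ m
  length-shifted = trans (ListP.length-map _ B.rows) B.length-rows
  zipWith-⧺ : zipWith _⧺_ S.rows B.rows ≡ zipWith _++_ S.rows shifted
  zipWith-⧺ = trans (sym (ListP.zipWith-map _++_ (λ xs → xs) (map (shiftAbs n₁)) S.rows B.rows))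
                    (cong (λ xss → zipWith _++_ xss shifted) (ListP.map-id S.rows))

stack : ∀ {m₁ m₂ r n₁ n₂} → RowSystem m₁ r n₁ → BalancedRowSystem m₂ r n₂ → RowSystem (m₁ + m₂) r (n₁ + n₂)
stack {n₁ = n₁} {n₂} S B = record
  { rows            = S.rows ++ map (map (shiftAbs n₁)) B.rows
  ; length-rows     = trans (ListP.length-++ S.rows)
                        (cong₂ _+_ S.length-rows (trans (ListP.length-map _ B.rows) B.length-rows))
  ; length-row      = AllP.++⁺ S.length-row (AllP.map⁺ (All.map (λ {ys} ℓys →
                        trans (ListP.length-map (shiftAbs n₁) ys) ℓys) B.length-row))
  ; sum-row         = AllP.++⁺ S.sum-row (AllP.map⁺ (All.map (λ {ys} (Σys , bys) →
                        sumℤ-map-shiftAbs-balanced n₁ ys Σys bys) (All.zip (B.sum-row , B.balanced-row))))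
  ; distinctAbs-row = AllP.++⁺ S.distinctAbs-row (AllP.map⁺ (All.map (distinctAbs-map-shiftAbs n₁) B.distinctAbs-row))
  ; concat-rows     = begin
      concat (S.rows ++ map (map (shiftAbs n₁)) B.rows)
        ≡⟨ ListP.concat-++ S.rows _ ⟨
      concat S.rows ++ concat (map (map (shiftAbs n₁)) B.rows)
        ↭⟨ concat-shifted S.rows B.rows S.concat-rows B.concat-rows ⟩
      signedRun (n₁ + n₂) ∎
  }
  where
  module S = RowSystem S
  module B = BalancedRowSystem B
  open PermutationReasoning

stackᴮ : ∀ {m₁ m₂ r n₁ n₂} → BalancedRowSystem m₁ r n₁ → BalancedRowSystem m₂ r n₂ →
  BalancedRowSystem (m₁ + m₂) r (n₁ + n₂)
stackᴮ {n₁ = n₁} A B = record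
  { system       = stack (BalancedRowSystem.system A) B
  ; balanced-row = AllP.++⁺ (BalancedRowSystem.balanced-row A)
      (AllP.map⁺ (All.map (λ {ys} bys → trans (balance-map-shiftAbs n₁ ys) bys) (BalancedRowSystem.balanced-row B)))
  }

-- Small balanced row systems, certified by computation

extract : (x : ℤ) (ys : List ℤ) → Maybe (∃ λ zs → ys ↭ x ∷ zs)
extract x []       = nothing
extract x (y ∷ ys) with x ℤ.≟ y | extract x ys
... | yes refl | _                 = just (ys , ↭-refl)
... | no  _    | nothing           = nothing
... | no  _    | just (zs , ys↭xzs) = just (y ∷ zs , ↭-trans (prep y ys↭xzs) (swap y x ↭-refl))

findPermutation : (xs ys : List ℤ) → Maybe (xs ↭ ys)
findPermutation []       []      = just ↭-refl
findPermutation []       (_ ∷ _) = nothing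
findPermutation (x ∷ xs) ys with extract x ys
... | nothing           = nothing
... | just (zs , ys↭xzs) with findPermutation xs zs
...   | nothing    = nothing
...   | just xs↭zs = just (↭-trans (prep x xs↭zs) (↭-sym ys↭xzs))

checkRowSystem : ∀ m r n (rows : List (List ℤ)) → Maybe (RowSystem m r n)
checkRowSystem m r n rows
  with length rows ℕ.≟ m
     | All.all? (λ xs → length xs ℕ.≟ r) rows
     | All.all? (λ xs → sumℤ xs ℤ.≟ + 0) rows
     | All.all? (AllPairs.allPairs? (λ x y → ¬? (∣ x ∣ ℕ.≟ ∣ y ∣))) rows
     | findPermutation (concat rows) (signedRun n)
... | yes ℓ | yes ℓs | yes Σs | yes ds | just p = just (record
  { rows = rows ; length-rows = ℓ ; length-row = ℓs ; sum-row = Σs ; distinctAbs-row = ds ; concat-rows = p })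
... | _ | _ | _ | _ | _ = nothing

checkBalancedRowSystem : ∀ m r n (rows : List (List ℤ)) → Maybe (BalancedRowSystem m r n)
checkBalancedRowSystem m r n rows with checkRowSystem m r n rows
... | nothing = nothing
... | just S with All.all? (λ xs → balance xs ℤ.≟ + 0) (RowSystem.rows S)
...   | yes bs = just (record { system = S ; balanced-row = bs })
...   | no  _  = nothing

balanced-2×4 : BalancedRowSystem 2 4 4
balanced-2×4 = from-just (checkBalancedRowSystem 2 4 4
  ( (+ 1 ∷ - + 2 ∷ - + 3 ∷ + 4 ∷ [])
  ∷ (- + 1 ∷ + 2 ∷ + 3 ∷ - + 4 ∷ [])
  ∷ []))

balanced-3×4 : BalancedRowSystem 3 4 6
balanced-3×4 = from-just (checkBalancedRowSystem 3 4 6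
  ( (+ 1 ∷ - + 2 ∷ - + 5 ∷ + 6 ∷ [])
  ∷ (+ 3 ∷ - + 4 ∷ - + 1 ∷ + 2 ∷ [])
  ∷ (+ 5 ∷ - + 6 ∷ - + 3 ∷ + 4 ∷ [])
  ∷ []))

balanced-3×6 : BalancedRowSystem 3 6 9
balanced-3×6 = from-just (checkBalancedRowSystem 3 6 9
  ( (+ 2 ∷ + 4 ∷ - + 7 ∷ - + 3 ∷ - + 5 ∷ + 9 ∷ [])
  ∷ (+ 1 ∷ + 6 ∷ - + 8 ∷ - + 2 ∷ - + 4 ∷ + 7 ∷ [])
  ∷ (+ 3 ∷ + 5 ∷ - + 9 ∷ - + 1 ∷ - + 6 ∷ + 8 ∷ [])
  ∷ []))

balanced-4×6 : BalancedRowSystem 4 6 12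
balanced-4×6 = from-just (checkBalancedRowSystem 4 6 12
  ( (+ 2 ∷ + 9 ∷ - + 12 ∷ - + 1 ∷ - + 6 ∷ + 8 ∷ [])
  ∷ (+ 3 ∷ + 7 ∷ - + 11 ∷ - + 2 ∷ - + 9 ∷ + 12 ∷ [])
  ∷ (+ 4 ∷ + 5 ∷ - + 10 ∷ - + 3 ∷ - + 7 ∷ + 11 ∷ [])
  ∷ (+ 1 ∷ + 6 ∷ - + 8 ∷ - + 4 ∷ - + 5 ∷ + 10 ∷ [])
  ∷ []))

balanced-5×6 : BalancedRowSystem 5 6 15
balanced-5×6 = from-just (checkBalancedRowSystem 5 6 15
  ( (+ 6 ∷ + 7 ∷ - + 15 ∷ - + 4 ∷ - + 5 ∷ + 11 ∷ [])
  ∷ (+ 10 ∷ + 2 ∷ - + 14 ∷ - + 6 ∷ - + 7 ∷ + 15 ∷ [])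
  ∷ (+ 8 ∷ + 3 ∷ - + 13 ∷ - + 10 ∷ - + 2 ∷ + 14 ∷ [])
  ∷ (+ 9 ∷ + 1 ∷ - + 12 ∷ - + 8 ∷ - + 3 ∷ + 13 ∷ [])
  ∷ (+ 4 ∷ + 5 ∷ - + 11 ∷ - + 9 ∷ - + 1 ∷ + 12 ∷ [])
  ∷ []))

suc-+-suc : ∀ m n → suc m + suc n ≡ 2 + (m + n)
suc-+-suc m n = cong suc (ℕP.+-suc m n)

+-2+ : ∀ m n → m + (2 + n) ≡ 2 + (m + n)
+-2+ m n = trans (ℕP.+-suc m (suc n)) (cong suc (ℕP.+-suc m n))

rows₃ : (a b c e l : ℕ) → List (List ℤ)
rows₃ a b c e zero    = []
rows₃ a b c e (suc l) = (+[1+ a ] ∷ +[1+ b ] ∷ -[1+ suc e ] ∷ [])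
                      ∷ (-[1+ l ] ∷ -[1+ e ] ∷ +[1+ c ] ∷ [])
                      ∷ rows₃ (suc a) (suc b) (suc c) (2 + e) l

length-rows₃ : ∀ a b c e l → length (rows₃ a b c e l) ≡ l + l
length-rows₃ a b c e zero    = refl
length-rows₃ a b c e (suc l) = trans (cong (suc ∘ suc) (length-rows₃ _ _ _ _ l)) (sym (cong suc (ℕP.+-suc l l)))

length-row-rows₃ : ∀ a b c e l → All (λ xs → length xs ≡ 3) (rows₃ a b c e l)
length-row-rows₃ a b c e zero    = []
length-row-rows₃ a b c e (suc l) = refl ∷ refl ∷ length-row-rows₃ _ _ _ _ l

sum-row-rows₃ : ∀ a b c e l → e ≡ a + b → c ≡ l + e → All (λ xs → sumℤ xs ≡ + 0) (rows₃ a b c e l)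
sum-row-rows₃ a b c e zero    _    _    = []
sum-row-rows₃ a b c e (suc l) refl refl =
  posPart≡negPart⇒sumℤ≡0 (+[1+ a ] ∷ +[1+ b ] ∷ -[1+ suc (a + b) ] ∷ []) (first a b) ∷
  posPart≡negPart⇒sumℤ≡0 (-[1+ l ] ∷ -[1+ e ] ∷ +[1+ suc l + e ] ∷ []) (second l e) ∷
  sum-row-rows₃ _ _ _ _ l (sym (suc-+-suc a b)) (sym (+-2+ l e))
  where
  first : ∀ a b → suc a + (suc b + 0) ≡ suc (suc (a + b)) + 0
  first = ℕ-Solver.solve-∀
  second : ∀ l e → suc (suc l + e) + 0 ≡ suc l + (suc e + 0)
  second = ℕ-Solver.solve-∀

distinctAbs-row-rows₃ : ∀ a b c e l → a < b → e ≡ a + b → c ≡ l + e → l ≤ e → All DistinctAbs (rows₃ a b c e l)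
distinctAbs-row-rows₃ a b c e zero    _   _    _    _   = []
distinctAbs-row-rows₃ a b c e (suc l) a<b refl refl l<e =
  increasingAbs⇒distinctAbs (s≤s a<b ∷ s≤s (s≤s (ℕP.m≤n+m b a)) ∷ [-]) ∷
  increasingAbs⇒distinctAbs (s≤s l<e ∷ s≤s (s≤s (ℕP.m≤n+m e l)) ∷ [-]) ∷
  distinctAbs-row-rows₃ _ _ _ _ l (s≤s a<b) (sym (suc-+-suc a b)) (sym (+-2+ l e)) (ℕP.m≤n⇒m≤o+n 2 (ℕP.<⇒≤ l<e))

concat-rows₃ : ∀ a b c e l → concat (rows₃ a b c e l) ↭
  posRun a l ++ posRun b l ++ posRun c l ++ negRunDown l ++ negRun e (l + l)
concat-rows₃ a b c e zero    = ↭-refl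
concat-rows₃ a b c e (suc l) rewrite ℕP.+-suc l l = ↭-trans
  (↭P.++⁺ˡ (+[1+ a ] ∷ +[1+ b ] ∷ -[1+ suc e ] ∷ -[1+ l ] ∷ -[1+ e ] ∷ +[1+ c ] ∷ [])
    (concat-rows₃ (suc a) (suc b) (suc c) (2 + e) l))
  (solve 11 (λ +a +b -e₂ -l -e +c A B C L E →
    +a ⊕ (+b ⊕ (-e₂ ⊕ (-l ⊕ (-e ⊕ (+c ⊕ (A ⊕ (B ⊕ (C ⊕ (L ⊕ E)))))))))
    ⊜ (+a ⊕ A) ⊕ ((+b ⊕ B) ⊕ ((+c ⊕ C) ⊕ ((-l ⊕ L) ⊕ (-e ⊕ (-e₂ ⊕ E)))))) ↭-refl
    [ +[1+ a ] ] [ +[1+ b ] ] [ -[1+ suc e ] ] [ -[1+ l ] ] [ -[1+ e ] ] [ +[1+ c ] ]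
    (posRun (suc a) l) (posRun (suc b) l) (posRun (suc c) l) (negRunDown l) (negRun (2 + e) (l + l)))

rowSystem₃ : ∀ q → 1 ≤ q → RowSystem (q + q) 3 (q + (q + q))
rowSystem₃ q 1≤q = record
  { rows            = rows₃ 0 q (q + q) q q
  ; length-rows     = length-rows₃ 0 q (q + q) q q
  ; length-row      = length-row-rows₃ 0 q (q + q) q q
  ; sum-row         = sum-row-rows₃ 0 q (q + q) q q refl refl
  ; distinctAbs-row = distinctAbs-row-rows₃ 0 q (q + q) q q 1≤q refl refl ℕP.≤-refl
  ; concat-rows     = begin
      concat (rows₃ 0 q (q + q) q q)
        ↭⟨ concat-rows₃ 0 q (q + q) q q ⟩
      P₀ ++ P₁ ++ P₂ ++ negRunDown q ++ negRun q (q + q)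
        ≡⟨ cong (P₀ ++_) (ListP.++-assoc P₁ P₂ _) ⟨
      P₀ ++ (P₁ ++ P₂) ++ negRunDown q ++ negRun q (q + q)
        ≡⟨ ListP.++-assoc P₀ (P₁ ++ P₂) _ ⟨
      (P₀ ++ P₁ ++ P₂) ++ negRunDown q ++ negRun q (q + q)
        ↭⟨ ↭P.++⁺ˡ (P₀ ++ P₁ ++ P₂) (↭P.++⁺ʳ _ (negRunDown↭negRun q)) ⟩
      (P₀ ++ P₁ ++ P₂) ++ negRun 0 q ++ negRun q (q + q)
        ≡⟨ cong₂ _++_ (trans (run-+ _ 0 q (q + q)) (cong (P₀ ++_) (run-+ _ q q q))) (run-+ _ 0 q (q + q)) ⟨
      signedRun (q + (q + q)) ∎
  }
  where
  open PermutationReasoning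
  P₀ = posRun 0 q
  P₁ = posRun q q
  P₂ = posRun (q + q) q

pairRows : ℕ → ℕ → List (List ℤ)
pairRows d zero    = []
pairRows d (suc l) = (-[1+ d ] ∷ +[1+ suc d ] ∷ []) ∷ (+[1+ d ] ∷ -[1+ suc d ] ∷ []) ∷ pairRows (2 + d) l

concat-pairRows : ∀ d l → concat (pairRows d l) ↭ posRun d (l + l) ++ negRun d (l + l)
concat-pairRows d zero    = ↭-refl
concat-pairRows d (suc l) rewrite ℕP.+-suc l l = ↭-trans
  (↭P.++⁺ˡ (-[1+ d ] ∷ +[1+ suc d ] ∷ +[1+ d ] ∷ -[1+ suc d ] ∷ []) (concat-pairRows (2 + d) l))
  (solve 6 (λ -d +d₁ +d -d₁ P N → -d ⊕ (+d₁ ⊕ (+d ⊕ (-d₁ ⊕ (P ⊕ N)))) ⊜ (+d ⊕ (+d₁ ⊕ P)) ⊕ (-d ⊕ (-d₁ ⊕ N))) ↭-refl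
    [ -[1+ d ] ] [ +[1+ suc d ] ] [ +[1+ d ] ] [ -[1+ suc d ] ] (posRun (2 + d) (l + l)) (negRun (2 + d) (l + l)))

rows₅ : (a b c e d l : ℕ) → List (List ℤ)
rows₅ a b c e d l = zipWith _++_ (rows₃ a b c e l) (pairRows d l)

length-rows₅ : ∀ a b c e d l → length (rows₅ a b c e d l) ≡ l + l
length-rows₅ a b c e d zero    = refl
length-rows₅ a b c e d (suc l) = trans (cong (suc ∘ suc) (length-rows₅ _ _ _ _ _ l)) (sym (cong suc (ℕP.+-suc l l)))

length-row-rows₅ : ∀ a b c e d l → All (λ xs → length xs ≡ 5) (rows₅ a b c e d l)
length-row-rows₅ a b c e d zero    = []
length-row-rows₅ a b c e d (suc l) = refl ∷ refl ∷ length-row-rows₅ _ _ _ _ _ l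

sum-row-rows₅ : ∀ a b c e d l → e ≡ suc (a + b) → c ≡ suc l + e → All (λ xs → sumℤ xs ≡ + 0) (rows₅ a b c e d l)
sum-row-rows₅ a b c e d zero    _    _    = []
sum-row-rows₅ a b c e d (suc l) refl refl =
  posPart≡negPart⇒sumℤ≡0 (+[1+ a ] ∷ +[1+ b ] ∷ -[1+ 2 + (a + b) ] ∷ -[1+ d ] ∷ +[1+ suc d ] ∷ []) (first a b d) ∷
  posPart≡negPart⇒sumℤ≡0 (-[1+ l ] ∷ -[1+ e ] ∷ +[1+ 2 + l + e ] ∷ +[1+ d ] ∷ -[1+ suc d ] ∷ []) (second l e d) ∷
  sum-row-rows₅ _ _ _ _ _ l (sym (cong suc (suc-+-suc a b))) (sym (cong suc (+-2+ l e)))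
  where
  first : ∀ a b d → suc a + (suc b + (2 + d + 0)) ≡ 3 + (a + b) + (suc d + 0)
  first = ℕ-Solver.solve-∀
  second : ∀ l e d → suc (2 + l + e) + (suc d + 0) ≡ suc l + (suc e + (2 + d + 0))
  second = ℕ-Solver.solve-∀

distinctAbs-row-rows₅ : ∀ a b c e d l → a < b → e ≡ suc (a + b) → c ≡ suc l + e → l ≤ e → suc e < d → c < d →
  All DistinctAbs (rows₅ a b c e d l)
distinctAbs-row-rows₅ a b c e d zero    _   _    _    _   _     _   = []
distinctAbs-row-rows₅ a b c e d (suc l) a<b refl refl l<e 1+e<d c<d =
  increasingAbs⇒distinctAbs (s≤s a<b ∷ s≤s (s≤s (ℕP.m≤n⇒m≤1+n (ℕP.m≤n+m b a))) ∷ s≤s 1+e<d ∷ s≤s (ℕP.n<1+n d) ∷ [-]) ∷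
  increasingAbs⇒distinctAbs (s≤s l<e ∷ s≤s (s≤s (ℕP.m≤n⇒m≤1+n (ℕP.m≤n+m e l))) ∷ s≤s c<d ∷ s≤s (ℕP.n<1+n d) ∷ [-]) ∷
  distinctAbs-row-rows₅ _ _ _ _ _ l (s≤s a<b) (sym (cong suc (suc-+-suc a b))) (sym (cong suc (+-2+ l e)))
    (ℕP.m≤n⇒m≤o+n 2 (ℕP.<⇒≤ l<e)) (s≤s (s≤s 1+e<d)) (ℕP.m<n⇒m<1+n (s≤s c<d))

concat-rows₅ : ∀ a b c e d l → concat (rows₅ a b c e d l) ↭
  (posRun a l ++ posRun b l ++ posRun c l ++ negRunDown l ++ negRun e (l + l)) ++ (posRun d (l + l) ++ negRun d (l + l))
concat-rows₅ a b c e d l = ↭-trans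
  (concat-zipWith-++ (rows₃ a b c e l) (pairRows d l) (trans (length-rows₃ a b c e l) (sym (length-pairRows d l))))
  (↭P.++⁺ (concat-rows₃ a b c e l) (concat-pairRows d l))
  where
  length-pairRows : ∀ d l → length (pairRows d l) ≡ l + l
  length-pairRows d zero    = refl
  length-pairRows d (suc l) = trans (cong (suc ∘ suc) (length-pairRows _ l)) (sym (cong suc (ℕP.+-suc l l)))

<-of-≡ : ∀ a c {b} → b ≡ suc a + c → a < b
<-of-≡ a c refl = s≤s (ℕP.m≤m+n a c)

-- With q = t + 2, the rows of rows₅ cover ±1, …, ±5q except for ten values, which form
-- the two extra rows (q, -(q+1), 2q, 3q+1, -5q) and (-q, 2q+1, -3q, -(3q+1), 5q).
module FiveColumns (t : ℕ) where

  p q T X Y n : ℕ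
  p = suc t
  q = suc p
  T = q + (q + q)
  X = suc (T + (p + p))
  Y = suc (q + (p + p))
  n = q + ((q + q) + (q + q))

  S₁ S₂ : List ℤ
  S₁ = +[1+ p ] ∷ -[1+ q ] ∷ +[1+ q + p ] ∷ +[1+ T ] ∷ -[1+ X ] ∷ []
  S₂ = -[1+ p ] ∷ +[1+ q + q ] ∷ -[1+ Y ] ∷ -[1+ T ] ∷ +[1+ X ] ∷ []

  family : List (List ℤ)
  family = rows₅ 0 q (suc (q + q)) (suc q) (suc T) p

  sum-S₁ : sumℤ S₁ ≡ + 0
  sum-S₁ = posPart≡negPart⇒sumℤ≡0 S₁ (parts-S₁ p T)
    where
    parts-S₁ : ∀ p T → suc p + (suc (suc p + p) + (suc T + 0)) ≡ suc (suc p) + (suc (suc (T + (p + p))) + 0)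
    parts-S₁ = ℕ-Solver.solve-∀

  sum-S₂ : sumℤ S₂ ≡ + 0
  sum-S₂ = posPart≡negPart⇒sumℤ≡0 S₂ (parts-S₂ p T)
    where
    parts-S₂ : ∀ p T → suc (suc p + suc p) + (suc (suc (T + (p + p))) + 0)
                       ≡ suc p + (suc (suc (suc p + (p + p))) + (suc T + 0))
    parts-S₂ = ℕ-Solver.solve-∀

  distinctAbs-S₁ : DistinctAbs S₁
  distinctAbs-S₁ = increasingAbs⇒distinctAbs
    (s≤s (ℕP.n<1+n p) ∷ s≤s (<-of-≡ q t (ℕP.+-suc q t)) ∷ s≤s (<-of-≡ (q + p) q (shape p))
    ∷ s≤s (s≤s (ℕP.m≤m+n T (p + p))) ∷ [-])
    where
    shape : ∀ p → suc p + (suc p + suc p) ≡ suc (suc p + p) + suc p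
    shape = ℕ-Solver.solve-∀

  distinctAbs-S₂ : DistinctAbs S₂
  distinctAbs-S₂ = increasingAbs⇒distinctAbs
    (s≤s (<-of-≡ p q refl) ∷ s≤s (<-of-≡ (q + q) t (shape-Y t)) ∷ s≤s (<-of-≡ Y 0 (shape-T t))
    ∷ s≤s (s≤s (ℕP.m≤m+n T (p + p))) ∷ [-])
    where
    shape-Y : ∀ t → suc (suc (suc t) + (suc t + suc t)) ≡ suc (suc (suc t) + suc (suc t)) + t
    shape-Y = ℕ-Solver.solve-∀
    shape-T : ∀ t → suc (suc t) + (suc (suc t) + suc (suc t)) ≡ suc (suc (suc (suc t) + (suc t + suc t))) + 0
    shape-T = ℕ-Solver.solve-∀

  run-bracket : ∀ (f : ℕ → ℤ) a → run f a (q + q) ≡ f a ∷ (run f (suc a) (p + p) ∷ʳ f (suc a + (p + p)))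
  run-bracket f a = cong (f a ∷_) (trans (cong (run f (suc a)) (ℕP.+-suc p p)) (run-suc f (suc a) (p + p)))

  run-split : ∀ (f : ℕ → ℤ) → run f 0 n ≡ run f 0 q ++ run f q (q + q) ++ run f T (q + q)
  run-split f = trans (run-+ f 0 q _) (cong (run f 0 q ++_) (run-+ f q (q + q) (q + q)))

  posRun-blocks : posRun 0 n ≡ (posRun 0 p ∷ʳ +[1+ p ])
    ++ ((posRun q p ∷ʳ +[1+ q + p ]) ++ (+[1+ q + q ] ∷ posRun (suc (q + q)) p))
    ++ (+[1+ T ] ∷ (posRun (suc T) (p + p) ∷ʳ +[1+ X ]))
  posRun-blocks = trans (run-split _) (cong₂ _++_ (run-suc _ 0 p) (cong₂ _++_
    (trans (run-+ _ q q q) (cong (_++ posRun (q + q) q) (run-suc _ q p))) (run-bracket _ T)))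

  negRun-blocks : negRun 0 n ≡ negRun 0 q
    ++ (-[1+ q ] ∷ (negRun (suc q) (p + p) ∷ʳ -[1+ Y ])) ++ (-[1+ T ] ∷ (negRun (suc T) (p + p) ∷ʳ -[1+ X ]))
  negRun-blocks = trans (run-split _) (cong (negRun 0 q ++_) (cong₂ _++_ (run-bracket _ q) (run-bracket _ T)))

  concat-rows : concat (S₁ ∷ S₂ ∷ family) ↭ signedRun n
  concat-rows = begin
    (S₁ ++ S₂) ++ concat family
      ↭⟨ ↭P.++⁺ˡ (S₁ ++ S₂) (concat-rows₅ 0 q (suc (q + q)) (suc q) (suc T) p) ⟩
    (S₁ ++ S₂) ++ (P₀ ++ P₁ ++ P₂ ++ D ++ N₁) ++ (P₃ ++ N₃)
      ↭⟨ solve 17 (λ +q -q₁ +2q +3q₁ -5q -q +2q₁ -3q -3q₁ +5q P₀ P₁ P₂ D N₁ P₃ N₃ →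
           +q ⊕ (-q₁ ⊕ (+2q ⊕ (+3q₁ ⊕ (-5q ⊕ (-q ⊕ (+2q₁ ⊕ (-3q ⊕ (-3q₁ ⊕ (+5q ⊕
             ((P₀ ⊕ (P₁ ⊕ (P₂ ⊕ (D ⊕ N₁)))) ⊕ (P₃ ⊕ N₃)))))))))))
           ⊜ ((P₀ ⊕ +q) ⊕ (((P₁ ⊕ +2q) ⊕ (+2q₁ ⊕ P₂)) ⊕ (+3q₁ ⊕ (P₃ ⊕ +5q))))
             ⊕ ((-q ⊕ D) ⊕ ((-q₁ ⊕ (N₁ ⊕ -3q)) ⊕ (-3q₁ ⊕ (N₃ ⊕ -5q))))) ↭-refl
           [ +[1+ p ] ] [ -[1+ q ] ] [ +[1+ q + p ] ] [ +[1+ T ] ] [ -[1+ X ] ]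
           [ -[1+ p ] ] [ +[1+ q + q ] ] [ -[1+ Y ] ] [ -[1+ T ] ] [ +[1+ X ] ]
           P₀ P₁ P₂ D N₁ P₃ N₃ ⟩
    posBlocks ++ (negRunDown q ++ negBlocks)
      ↭⟨ ↭P.++⁺ˡ posBlocks (↭P.++⁺ʳ negBlocks (negRunDown↭negRun q)) ⟩
    posBlocks ++ (negRun 0 q ++ negBlocks)
      ≡⟨ cong₂ _++_ posRun-blocks negRun-blocks ⟨
    signedRun n ∎
    where
    open PermutationReasoning
    P₀ = posRun 0 p
    P₁ = posRun q p
    P₂ = posRun (suc (q + q)) p
    P₃ = posRun (suc T) (p + p)
    D  = negRunDown p
    N₁ = negRun (suc q) (p + p)
    N₃ = negRun (suc T) (p + p)
    posBlocks = (P₀ ∷ʳ +[1+ p ]) ++ ((P₁ ∷ʳ +[1+ q + p ]) ++ (+[1+ q + q ] ∷ P₂)) ++ (+[1+ T ] ∷ (P₃ ∷ʳ +[1+ X ]))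
    negBlocks = (-[1+ q ] ∷ (N₁ ∷ʳ -[1+ Y ])) ++ (-[1+ T ] ∷ (N₃ ∷ʳ -[1+ X ]))

  rowSystem : RowSystem (q + q) 5 n
  rowSystem = record
    { rows            = S₁ ∷ S₂ ∷ family
    ; length-rows     = trans (cong (suc ∘ suc) (length-rows₅ 0 q (suc (q + q)) (suc q) (suc T) p)) (sym (suc-+-suc p p))
    ; length-row      = refl ∷ refl ∷ length-row-rows₅ 0 q (suc (q + q)) (suc q) (suc T) p
    ; sum-row         = sum-S₁ ∷ sum-S₂ ∷ sum-row-rows₅ 0 q (suc (q + q)) (suc q) (suc T) p refl (sym (ℕP.+-suc q q))
    ; distinctAbs-row = distinctAbs-S₁ ∷ distinctAbs-S₂ ∷ distinctAbs-row-rows₅ 0 q (suc (q + q)) (suc q) (suc T) p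
                          (s≤s z≤n) refl (sym (ℕP.+-suc q q)) (ℕP.m≤n⇒m≤1+n (ℕP.n≤1+n p))
                          (s≤s (<-of-≡ (suc q) (p + p) (T-shape₁ p))) (s≤s (<-of-≡ (q + q) p (T-shape₂ p)))
    ; concat-rows     = concat-rows
    }
    where
    T-shape₁ : ∀ p → suc p + (suc p + suc p) ≡ suc (suc (suc p)) + (p + p)
    T-shape₁ = ℕ-Solver.solve-∀
    T-shape₂ : ∀ p → suc p + (suc p + suc p) ≡ suc (suc p + suc p) + p
    T-shape₂ = ℕ-Solver.solve-∀

HasRowSystem HasBalancedRowSystem : ℕ → ℕ → Set
HasRowSystem         m r = ∃ (RowSystem m r)
HasBalancedRowSystem m r = ∃ (BalancedRowSystem m r)

forgetBalance : ∀ {m r} → HasBalancedRowSystem m r → HasRowSystem m r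
forgetBalance (n , B) = n , BalancedRowSystem.system B

balanced₄ : ∀ {m} → 2 ≤ m → HasBalancedRowSystem m 4
balanced₄ (s≤s (s≤s {n = k} _)) = go k
  where
  go : ∀ k → HasBalancedRowSystem (2 + k) 4
  go zero          = 4 , balanced-2×4
  go (suc zero)    = 6 , balanced-3×4
  go (suc (suc k)) with go k
  ... | n , B = 4 + n , stackᴮ balanced-2×4 B

balanced₆ : ∀ {m} → 3 ≤ m → HasBalancedRowSystem m 6
balanced₆ (s≤s (s≤s (s≤s {n = k} _))) = go k
  where
  go : ∀ k → HasBalancedRowSystem (3 + k) 6
  go zero                = 9 , balanced-3×6
  go (suc zero)          = 12 , balanced-4×6
  go (suc (suc zero))    = 15 , balanced-5×6
  go (suc (suc (suc k))) with go k
  ... | n , B = 9 + n , stackᴮ balanced-3×6 B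

widen : ∀ {m r} → HasBalancedRowSystem m 4 → HasRowSystem m r → ∀ j → HasRowSystem m (r + j * 4)
widen {m} {r} _ S zero = subst (HasRowSystem m) (sym (ℕP.+-identityʳ r)) S
widen {m} {r} B@(n₄ , B₄) S (suc j) with widen B S j
... | n , S′ = n + n₄ , subst (λ r′ → RowSystem m r′ (n + n₄)) (assoc r j) (juxtapose S′ B₄)
  where
  assoc : ∀ r j → r + j * 4 + 4 ≡ r + suc j * 4
  assoc = ℕ-Solver.solve-∀

data Residue : ℕ → Set where
  three : ∀ j → Residue (3 + j * 4)
  four  : ∀ j → Residue (4 + j * 4)
  five  : ∀ j → Residue (5 + j * 4)
  six   : ∀ j → Residue (6 + j * 4)

residue : ∀ r → 3 ≤ r → Residue r
residue 1 (s≤s ())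
residue 2 (s≤s (s≤s ()))
residue 3 _ = three 0
residue 4 _ = four 0
residue 5 _ = five 0
residue 6 _ = six 0
residue (suc (suc (suc (suc r@(suc (suc (suc _))))))) _ with residue r (s≤s (s≤s (s≤s z≤n)))
... | three j = three (suc j)
... | four  j = four (suc j)
... | five  j = five (suc j)
... | six   j = six (suc j)

even-factor : ∀ m r n → m * r ≡ n * 2 → r % 2 ≡ 1 → ∃ λ q → m ≡ q + q
even-factor m r n m*r≡n*2 r%2≡1 with m % 2 in m%2≡ | m%n<n m 2
... | 0 | _ = m / 2 , trans (m≡m%n+[m/n]*n m 2) (trans (cong (_+ m / 2 * 2) m%2≡) (m*2≡m+m (m / 2)))
... | 1 | _ = ⊥-elim (ℕP.1+n≢0 (begin
    1                           ≡⟨ cong (λ x → (1 * x) % 2) r%2≡1 ⟨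
    (1 * (r % 2)) % 2           ≡⟨ cong (λ x → (x * (r % 2)) % 2) m%2≡ ⟨
    ((m % 2) * (r % 2)) % 2     ≡⟨ %-distribˡ-* m r 2 ⟨
    (m * r) % 2                 ≡⟨ cong (_% 2) m*r≡n*2 ⟩
    (n * 2) % 2                 ≡⟨ m*n%n≡0 n 2 ⟩
    0                           ∎))
  where open ≡-Reasoning
... | suc (suc _) | s≤s (s≤s ())

[c+j*4]%2≡c%2 : ∀ c j → (c + j * 4) % 2 ≡ c % 2
[c+j*4]%2≡c%2 c j = trans (cong (_% 2) (shape c j)) ([m+kn]%n≡m%n c (j * 2) 2)
  where
  shape : ∀ c j → c + j * 4 ≡ c + j * 2 * 2
  shape = ℕ-Solver.solve-∀

oddColumns⇒evenRows : ∀ {m n} c j → 3 ≤ m → m * (c + j * 4) ≡ 2 * n → c % 2 ≡ 1 → ∃ λ t → m ≡ (2 + t) + (2 + t)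
oddColumns⇒evenRows {m} {n} c j 3≤m m*r≡2*n c%2≡1
  with even-factor m (c + j * 4) n (trans m*r≡2*n (ℕP.*-comm 2 n)) (trans ([c+j*4]%2≡c%2 c j) c%2≡1)
... | suc (suc t) , m≡ = t , m≡
... | 0     , refl = ⊥-elim (ℕP.<⇒≱ 3≤m z≤n)
... | 1     , refl = ⊥-elim (ℕP.<⇒≱ 3≤m (s≤s (s≤s z≤n)))

onEvenRows : ∀ {m c} → (∀ t → HasRowSystem ((2 + t) + (2 + t)) c) → (∃ λ t → m ≡ (2 + t) + (2 + t)) →
  HasRowSystem m c
onEvenRows S (t , refl) = S t

rowSystem-m≥3 : ∀ {m r n} → 3 ≤ m → 3 ≤ r → m * r ≡ 2 * n → HasRowSystem m r
rowSystem-m≥3 {m} {r} {n} 3≤m 3≤r m*r≡2*n with residue r 3≤r | balanced₄ (ℕP.≤-trans (ℕP.n≤1+n 2) 3≤m)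
... | three j | B₄ =
  widen B₄ (onEvenRows (λ t → _ , rowSystem₃ (2 + t) (s≤s z≤n)) (oddColumns⇒evenRows {n = n} 3 j 3≤m m*r≡2*n refl)) j
... | four  j | B₄ = widen B₄ (forgetBalance B₄) j
... | five  j | B₄ =
  widen B₄ (onEvenRows (λ t → _ , FiveColumns.rowSystem t) (oddColumns⇒evenRows {n = n} 5 j 3≤m m*r≡2*n refl)) j
... | six   j | B₄ = widen B₄ (forgetBalance (balanced₆ 3≤m)) j

rowSystem-m≡2 : ∀ {r} → 1 ≤ r → r % 4 ≡ 0 ⊎ r % 4 ≡ 3 → HasRowSystem 2 r
rowSystem-m≡2 {1} _ (inj₁ ())
rowSystem-m≡2 {1} _ (inj₂ ())
rowSystem-m≡2 {2} _ (inj₁ ())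
rowSystem-m≡2 {2} _ (inj₂ ())
rowSystem-m≡2 {r@(suc (suc (suc _)))} _ r%4 with residue r (s≤s (s≤s (s≤s z≤n))) | r%4
... | three j | _ = widen (4 , balanced-2×4) (_ , rowSystem₃ 1 (s≤s z≤n)) j
... | four  j | _ = widen (4 , balanced-2×4) (4 , system balanced-2×4) j
... | five  j | inj₁ r%4≡0 = contradiction (trans (sym ([m+kn]%n≡m%n 5 j 4)) r%4≡0) λ ()
... | five  j | inj₂ r%4≡3 = contradiction (trans (sym ([m+kn]%n≡m%n 5 j 4)) r%4≡3) λ ()
... | six   j | inj₁ r%4≡0 = contradiction (trans (sym ([m+kn]%n≡m%n 6 j 4)) r%4≡0) λ ()
... | six   j | inj₂ r%4≡3 = contradiction (trans (sym ([m+kn]%n≡m%n 6 j 4)) r%4≡3) λ ()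

hasRowSystem⇒SMR : ∀ {m r} n → HasRowSystem m r → m * r ≡ 2 * n → SMRExists m n r 2
hasRowSystem⇒SMR n (n′ , S) m*r≡2*n
  with ℕP.*-cancelʳ-≡ n′ n 2 (trans (sym (RowSystem.card S)) (trans m*r≡2*n (ℕP.*-comm 2 n)))
... | refl = rowSystem⇒SMR S

-- Necessary conditions

Unique-run : ∀ {A : Set} {f : ℕ → A} → (∀ {i j} → f i ≡ f j → i ≡ j) → ∀ c → Unique (run f 0 c)
Unique-run f-injective c = subst Unique (sym (run≡applyUpTo _ c))
  (UniqueP.applyUpTo⁺₁ _ c (λ i<j _ fi≡fj → ℕP.<⇒≢ i<j (f-injective fi≡fj)))

Unique-signedRun : ∀ k → Unique (signedRun k)
Unique-signedRun k = UniqueP.++⁺ (Unique-run (λ { refl → refl }) k) (Unique-run (λ { refl → refl }) k) disjoint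
  where
  ∈-run⇒image : ∀ (f : ℕ → ℤ) {x} → x ∈ run f 0 k → ∃ λ i → i < k × x ≡ f i
  ∈-run⇒image f x∈ = ∈P.∈-applyUpTo⁻ f (subst (_ ∈_) (run≡applyUpTo f k) x∈)
  disjoint : ∀ {x} → ¬ (x ∈ posRun 0 k × x ∈ negRun 0 k)
  disjoint (x∈pos , x∈neg) with ∈-run⇒image _ x∈pos | ∈-run⇒image _ x∈neg
  ... | _ , _ , refl | _ , _ , ()

0∉signedRun : ∀ k → + 0 ∉ signedRun k
0∉signedRun k 0∈ with ∈signedRun⁻ k 0∈
... | _ , _ , ()

Unique-symSet : ∀ N → Unique (symSet N)
Unique-symSet N with N % 2
... | zero  = subst Unique (sym (pmUpTo≡signedRun (N / 2))) (Unique-signedRun (N / 2))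
... | suc _ = subst Unique (sym (cong (+ 0 ∷_) (pmUpTo≡signedRun (N / 2))))
                (All.tabulate (λ x∈ 0≡x → 0∉signedRun (N / 2) (subst (_∈ _) (sym 0≡x) x∈)) ∷ Unique-signedRun (N / 2))

Unique-++⇒∉ : ∀ {A : Set} (xs : List A) {ys x} → Unique (xs ++ ys) → x ∈ xs → x ∉ ys
Unique-++⇒∉ (x ∷ xs) (x∉ ∷ _) (here refl)  x∈ys = All.lookup (AllP.++⁻ʳ xs x∉) x∈ys refl
Unique-++⇒∉ (_ ∷ xs) (_ ∷ u)  (there x∈xs) x∈ys = Unique-++⇒∉ xs u x∈xs x∈ys

Unique-++⁻ʳ : ∀ {A : Set} (xs : List A) {ys} → Unique (xs ++ ys) → Unique ys
Unique-++⁻ʳ []       u       = u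
Unique-++⁻ʳ (_ ∷ xs) (_ ∷ u) = Unique-++⁻ʳ xs u

Unique-concat-map⇒index : ∀ {I : Set} (g : I → List ℤ) is {i i′ x} → Unique (concat (map g is)) →
  i ∈ is → i′ ∈ is → x ∈ g i → x ∈ g i′ → i ≡ i′
Unique-concat-map⇒index g (k ∷ is) u (here refl) (here refl)  _   _    = refl
Unique-concat-map⇒index g (k ∷ is) u (here refl) (there i′∈) x∈  x∈′ =
  ⊥-elim (Unique-++⇒∉ (g k) u x∈ (∈P.∈-concat⁺′ x∈′ (∈P.∈-map⁺ g i′∈)))
Unique-concat-map⇒index g (k ∷ is) u (there i∈)  (here refl)  x∈  x∈′ =
  ⊥-elim (Unique-++⇒∉ (g k) u x∈′ (∈P.∈-concat⁺′ x∈ (∈P.∈-map⁺ g i∈)))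
Unique-concat-map⇒index g (k ∷ is) u (there i∈)  (there i′∈) x∈  x∈′ =
  Unique-concat-map⇒index g is (Unique-++⁻ʳ (g k) u) i∈ i′∈ x∈ x∈′

∈-catMaybes-map⁻ : ∀ {I : Set} (f : I → Maybe ℤ) is {x} → x ∈ catMaybes (map f is) → ∃ λ i → f i ≡ just x
∈-catMaybes-map⁻ f (i ∷ is) x∈ with f i in fi≡
∈-catMaybes-map⁻ f (i ∷ is) (here refl) | just _  = i , fi≡
∈-catMaybes-map⁻ f (i ∷ is) (there x∈)  | just _  = ∈-catMaybes-map⁻ f is x∈
∈-catMaybes-map⁻ f (i ∷ is) x∈          | nothing = ∈-catMaybes-map⁻ f is x∈

∈-catMaybes-map⁺ : ∀ {I : Set} (f : I → Maybe ℤ) {is i x} → i ∈ is → f i ≡ just x → x ∈ catMaybes (map f is)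
∈-catMaybes-map⁺ f {k ∷ is} (here refl) fi≡ rewrite fi≡ = here refl
∈-catMaybes-map⁺ f {k ∷ is} (there i∈)  fi≡ with f k
... | just _  = there (∈-catMaybes-map⁺ f i∈ fi≡)
... | nothing = ∈-catMaybes-map⁺ f i∈ fi≡

sum≡0⇒negation : ∀ a b → sumℤ (a ∷ b ∷ []) ≡ + 0 → b ≡ - a
sum≡0⇒negation a b sum≡0 = inverseʳ-unique a b (trans (cong (a +ℤ_) (sym (ℤP.+-identityʳ b))) sum≡0)

singleton-sum≡0 : ∀ xs → length xs ≡ 1 → sumℤ xs ≡ + 0 → + 0 ∈ xs
singleton-sum≡0 (x ∷ []) refl sum≡0 = here (sym (trans (sym (ℤP.+-identityʳ x)) sum≡0))

pair-sum≡0 : ∀ xs → length xs ≡ 2 → sumℤ xs ≡ + 0 → ∃₂ λ a b → xs ≡ a ∷ b ∷ [] × b ≡ - a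
pair-sum≡0 (a ∷ b ∷ []) refl sum≡0 = a , b , refl , sum≡0⇒negation a b sum≡0

-∈-pair : ∀ {a u w} → a ∈ u ∷ w ∷ [] → w ≡ - u → - a ∈ u ∷ w ∷ []
-∈-pair (here refl)         w≡-u = there (here (sym w≡-u))
-∈-pair {u = u} (there (here refl)) refl = here (ℤP.neg-involutive u)

≡-⇒≡0 : ∀ a → a ≡ - a → a ≡ + 0
≡-⇒≡0 (+ zero)   _  = refl
≡-⇒≡0 +[1+ _ ]   ()
≡-⇒≡0 -[1+ _ ]   ()

module SMRProperties {m n r} {A : PArray m n} (H : IsSMR m n r 2 A) where
  open IsSMR H

  rowIndex-unique : ∀ {x} i i′ → x ∈ rowEntries A i → x ∈ rowEntries A i′ → i ≡ i′
  rowIndex-unique i i′ = Unique-concat-map⇒index (rowEntries A) (allFin m)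
    (Unique-resp-↭ (setoid ℤ) (↭⇒↭ₛ (↭-sym entries)) (Unique-symSet (m * r))) (∈P.∈-allFin i) (∈P.∈-allFin i′)

  2≤m : Fin n → 2 ≤ m
  2≤m j = subst (_≤ m) (colCount j) (ℕP.≤-trans (ListP.length-catMaybes (map (λ i → A i j) (allFin m)))
    (ℕP.≤-reflexive (trans (ListP.length-map _ (allFin m)) (ListP.length-tabulate (λ i → i)))))

open SMRProperties

r≢1 : ∀ {m n} {A : PArray (2 + m) n} → ¬ IsSMR (2 + m) n 1 2 A
r≢1 {A = A} H with rowIndex-unique H (# 0) (# 1) (zero∈ (# 0)) (zero∈ (# 1))
  where
  zero∈ : ∀ i → + 0 ∈ rowEntries A i
  zero∈ i = singleton-sum≡0 (rowEntries A i) (IsSMR.rowCount H i) (IsSMR.rowSum H i)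
... | ()

-- In a row (a, -a), the column of a also holds -a, which can only lie in the same row;
-- hence a = -a = 0, but 0 is not an entry when mr is even.
r≢2 : ∀ {m n} {A : PArray (suc m) (suc n)} → ¬ IsSMR (suc m) (suc n) 2 2 A
r≢2 {m} {n} {A} H with pair-sum≡0 (rowEntries A (# 0)) (IsSMR.rowCount H (# 0)) (IsSMR.rowSum H (# 0))
... | a , b , row₀≡ , b≡-a =
  0∉signedRun (suc m) (subst (+ 0 ∈_) (symSet-double (suc m)) (↭P.∈-resp-↭ entries 0∈entries))
  where
  open IsSMR H
  a∈row₀ : a ∈ rowEntries A (# 0)
  a∈row₀ = subst (a ∈_) (sym row₀≡) (here refl)
  b∈row₀ : b ∈ rowEntries A (# 0)
  b∈row₀ = subst (b ∈_) (sym row₀≡) (there (here refl))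
  columnOf-a : ∃ λ j → A (# 0) j ≡ just a
  columnOf-a = ∈-catMaybes-map⁻ (A (# 0)) (allFin _) a∈row₀
  j = proj₁ columnOf-a
  a∈column : a ∈ colEntries A j
  a∈column = ∈-catMaybes-map⁺ (λ i → A i j) (∈P.∈-allFin (# 0)) (proj₂ columnOf-a)
  b∈column : b ∈ colEntries A j
  b∈column with pair-sum≡0 (colEntries A j) (colCount j) (colSum j)
  ... | u , w , column≡ , w≡-u = subst (b ∈_) (sym column≡)
    (subst (_∈ _) (sym b≡-a) (-∈-pair (subst (a ∈_) column≡ a∈column) w≡-u))
  rowOf-b : ∃ λ i → A i j ≡ just b
  rowOf-b = ∈-catMaybes-map⁻ (λ i → A i j) (allFin _) b∈column
  rowOf-b≡0 : proj₁ rowOf-b ≡ # 0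
  rowOf-b≡0 = rowIndex-unique H _ _ (∈-catMaybes-map⁺ (A (proj₁ rowOf-b)) (∈P.∈-allFin j) (proj₂ rowOf-b)) b∈row₀
  a≡b : a ≡ b
  a≡b = MaybeP.just-injective (trans (sym (proj₂ columnOf-a)) (subst (λ i → A i j ≡ just b) rowOf-b≡0 (proj₂ rowOf-b)))
  0∈entries : + 0 ∈ allEntries A
  0∈entries = ∈P.∈-concat⁺′ (subst (_∈ rowEntries A (# 0)) (≡-⇒≡0 a (trans a≡b b≡-a)) a∈row₀)
    (∈P.∈-map⁺ (rowEntries A) (∈P.∈-allFin (# 0)))

absSum : List ℤ → ℕ
absSum xs = sum (map ∣_∣ xs)

absSum-↭ : ∀ {xs ys} → xs ↭ ys → absSum xs ≡ absSum ys
absSum-↭ p = SumP.sum-↭ (↭P.map⁺ ∣_∣ p)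

absSum-++ : ∀ xs ys → absSum (xs ++ ys) ≡ absSum xs + absSum ys
absSum-++ xs ys = trans (cong sum (ListP.map-++ ∣_∣ xs ys)) (SumP.sum-++ (map ∣_∣ xs) (map ∣_∣ ys))

absSum≡posPart+negPart : ∀ xs → absSum xs ≡ posPart xs + negPart xs
absSum≡posPart+negPart []              = refl
absSum≡posPart+negPart (+ k ∷ xs)      = trans (cong (_+_ k) (absSum≡posPart+negPart xs)) (sym (ℕP.+-assoc k _ _))
absSum≡posPart+negPart (-[1+ k ] ∷ xs) = trans (cong (_+_ (suc k)) (absSum≡posPart+negPart xs))
  (+-leftComm (suc k) (posPart xs) (negPart xs))

sum-run-suc : ∀ a c → sum (run suc a c) * 2 ≡ c * (a + a + c + 1)
sum-run-suc a zero    = refl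
sum-run-suc a (suc c) = begin
  (suc a + sum (run suc (suc a) c)) * 2        ≡⟨ ℕP.*-distribʳ-+ 2 (suc a) _ ⟩
  suc a * 2 + sum (run suc (suc a) c) * 2      ≡⟨ cong (_+_ (suc a * 2)) (sum-run-suc (suc a) c) ⟩
  suc a * 2 + c * (suc a + suc a + c + 1)      ≡⟨ gauss a c ⟩
  suc c * (a + a + suc c + 1)                  ∎
  where
  open ≡-Reasoning
  gauss : ∀ a c → suc a * 2 + c * (suc a + suc a + c + 1) ≡ suc c * (a + a + suc c + 1)
  gauss = ℕ-Solver.solve-∀

absSum-signedRun : ∀ r → absSum (signedRun r) ≡ r * (r + 1)
absSum-signedRun r = begin
  absSum (posRun 0 r ++ negRun 0 r)          ≡⟨ absSum-++ (posRun 0 r) (negRun 0 r) ⟩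
  absSum (posRun 0 r) + absSum (negRun 0 r)  ≡⟨ cong₂ _+_ (cong sum (map-run _ ∣_∣ 0 r)) (cong sum (map-run _ ∣_∣ 0 r)) ⟩
  sum (run suc 0 r) + sum (run suc 0 r)      ≡⟨ m*2≡m+m (sum (run suc 0 r)) ⟨
  sum (run suc 0 r) * 2                      ≡⟨ sum-run-suc 0 r ⟩
  r * (r + 1)                                ∎
  where open ≡-Reasoning

residue-triangular : ∀ c j → (c + j * 4) * (c + j * 4 + 1) % 4 ≡ c * (c + 1) % 4
residue-triangular c j = trans (cong (_% 4) (expand c j)) ([m+kn]%n≡m%n (c * (c + 1)) (j * (c + c + 1) + j * j * 4) 4)
  where
  expand : ∀ c j → (c + j * 4) * (c + j * 4 + 1) ≡ c * (c + 1) + (j * (c + c + 1) + j * j * 4) * 4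
  expand = ℕ-Solver.solve-∀

triangular-mod4 : ∀ r → r * (r + 1) % 4 ≡ 0 → r % 4 ≡ 0 ⊎ r % 4 ≡ 3
triangular-mod4 0 _ = inj₁ refl
triangular-mod4 1 ()
triangular-mod4 2 ()
triangular-mod4 r@(suc (suc (suc _))) 4∣ with residue r (s≤s (s≤s (s≤s z≤n)))
... | three j = inj₂ ([m+kn]%n≡m%n 3 j 4)
... | four  j = inj₁ ([m+kn]%n≡m%n 4 j 4)
... | five  j = contradiction (trans (sym (residue-triangular 5 j)) 4∣) λ ()
... | six   j = contradiction (trans (sym (residue-triangular 6 j)) 4∣) λ ()

pair-abs : ∀ (u v : Maybe ℤ) → length (catMaybes (u ∷ v ∷ [])) ≡ 2 → sumℤ (catMaybes (u ∷ v ∷ [])) ≡ + 0 →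
  Maybe.map ∣_∣ v ≡ Maybe.map ∣_∣ u
pair-abs (just x) (just y) _  sum≡0 = cong just (trans (cong ∣_∣ (sum≡0⇒negation x y sum≡0)) (ℤP.∣-i∣≡∣i∣ x))
pair-abs (just _) nothing  () _
pair-abs nothing  (just _) () _
pair-abs nothing  nothing  () _

module TwoRows {n r} {A : PArray 2 n} (H : IsSMR 2 n r 2 A) where
  open IsSMR H
  open ≡-Reasoning

  row₀ row₁ : List ℤ
  row₀ = rowEntries A (# 0)
  row₁ = rowEntries A (# 1)

  absSum-row₁ : absSum row₁ ≡ absSum row₀
  absSum-row₁ = cong sum (trans (map-abs-row (# 1)) (trans
    (cong catMaybes (ListP.map-cong (λ j → pair-abs (A (# 0) j) (A (# 1) j) (colCount j) (colSum j)) (allFin n)))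
    (sym (map-abs-row (# 0)))))
    where
    map-abs-row : ∀ i → map ∣_∣ (rowEntries A i) ≡ catMaybes (map (λ j → Maybe.map ∣_∣ (A i j)) (allFin n))
    map-abs-row i = trans (ListP.map-catMaybes ∣_∣ (map (A i) (allFin n)))
      (cong catMaybes (sym (ListP.map-∘ {g = Maybe.map ∣_∣} {f = A i} (allFin n))))

  absSum-rows : absSum row₀ + absSum row₁ ≡ r * (r + 1)
  absSum-rows = begin
    absSum row₀ + absSum row₁          ≡⟨ cong (_+_ (absSum row₀)) (ℕP.+-identityʳ _) ⟨
    absSum row₀ + (absSum row₁ + 0)    ≡⟨ cong (_+_ (absSum row₀)) (absSum-++ row₁ []) ⟨
    absSum row₀ + absSum (row₁ ++ [])  ≡⟨ absSum-++ row₀ (row₁ ++ []) ⟨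
    absSum (allEntries A)              ≡⟨ absSum-↭ entries ⟩
    absSum (symSet (2 * r))            ≡⟨ cong (absSum ∘ symSet) (ℕP.*-comm 2 r) ⟩
    absSum (symSet (r * 2))            ≡⟨ cong absSum (symSet-double r) ⟩
    absSum (signedRun r)               ≡⟨ absSum-signedRun r ⟩
    r * (r + 1)                        ∎

  r*[r+1]≡negPart*4 : r * (r + 1) ≡ negPart row₀ * 4
  r*[r+1]≡negPart*4 = begin
    r * (r + 1)                        ≡⟨ absSum-rows ⟨
    absSum row₀ + absSum row₁          ≡⟨ cong (_+_ (absSum row₀)) absSum-row₁ ⟩
    absSum row₀ + absSum row₀          ≡⟨ cong (λ s → s + s) (absSum≡posPart+negPart row₀) ⟩
    (P + N) + (P + N)                  ≡⟨ cong (λ p → (p + N) + (p + N)) (sumℤ≡0⇒posPart≡negPart row₀ (rowSum (# 0))) ⟩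
    (N + N) + (N + N)                  ≡⟨ quadruple N ⟩
    N * 4                              ∎
    where
    P = posPart row₀
    N = negPart row₀
    quadruple : ∀ k → (k + k) + (k + k) ≡ k * 4
    quadruple = ℕ-Solver.solve-∀

  conditions : n ≡ r × (r % 4 ≡ 0 ⊎ r % 4 ≡ 3)
  conditions = sym (ℕP.*-cancelʳ-≡ r n 2 (trans (ℕP.*-comm r 2) cardEq))
             , triangular-mod4 r (trans (cong (_% 4) r*[r+1]≡negPart*4) (m*n%n≡0 (negPart row₀) 4))

necessity : ∀ m n r → SMRExists m (suc n) (suc r) 2 →
  (m ≡ 2 × suc n ≡ suc r × (suc r % 4 ≡ 0 ⊎ suc r % 4 ≡ 3)) ⊎ (m ≥ 3 × suc r ≥ 3 × m * suc r ≡ 2 * suc n)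
necessity m n r (A , H) with 2≤m H Fin.zero
necessity 1 n r (A , H) | s≤s ()
necessity 2 n r (A , H) | _ = inj₁ (refl , TwoRows.conditions H)
necessity (suc (suc (suc m))) n 0       (A , H) | _ = ⊥-elim (r≢1 H)
necessity (suc (suc (suc m))) n 1       (A , H) | _ = ⊥-elim (r≢2 H)
necessity (suc (suc (suc m))) n (suc (suc r)) (A , H) | _ =
  inj₂ (s≤s (s≤s (s≤s z≤n)) , s≤s (s≤s (s≤s z≤n)) , trans (IsSMR.cardEq H) (ℕP.*-comm (suc n) 2))

sufficiency : ∀ m n r →
  (m ≡ 2 × suc n ≡ suc r × (suc r % 4 ≡ 0 ⊎ suc r % 4 ≡ 3)) ⊎ (m ≥ 3 × suc r ≥ 3 × m * suc r ≡ 2 * suc n) →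
  SMRExists m (suc n) (suc r) 2
sufficiency 2 n r (inj₁ (refl , refl , r%4)) = hasRowSystem⇒SMR (suc n) (rowSystem-m≡2 (s≤s z≤n) r%4) refl
sufficiency m n r (inj₂ (3≤m , 3≤r , m*r≡2*n)) =
  hasRowSystem⇒SMR (suc n) (rowSystem-m≥3 {n = suc n} 3≤m 3≤r m*r≡2*n) m*r≡2*n

mainTheorem1 : (m n r : ℕ) → .{{NonZero m}} → .{{NonZero n}} → .{{NonZero r}} →
    SMRExists m n r 2 ⇔
      ((m ≡ 2 × n ≡ r × (r % 4 ≡ 0 ⊎ r % 4 ≡ 3))
        ⊎ (m ≥ 3 × r ≥ 3 × m * r ≡ 2 * n))
mainTheorem1 m (suc n) (suc r) = mk⇔ (necessity m n r) (sufficiency m n r)
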